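{- For every $k\ge1$, $\bar\sigma_{\mathrm{U\text{ - }MMR}}(k)-\bar\sigma_{\mathrm{U\text{ - }MMB}}(k)\ge\frac54-\frac{3}{2(k+1)}$.
   Context: A mountain of height $s\ge0$ is a perfect binary tree with $2^s$ leaves; its root is its peak. The U-MMB with $n$ leaves is an ordered (left-to-right) list of mountains whose leaves read left to right are $h_1,\dots,h_n$, built inductively from the empty list: the $n$-th append (1) adds $h_n$ as a height-0 mountain at the right end, and (2) if there exist two consecutive mountains of equal height, takes the rightmost such pair, of height $s$, and replaces it in place by a mountain of height $s+1$ whose new peak has the two old peaks as children. The U-MMR with $n$ leaves is the ordered list of mountains, one of height $i$ for each 1-bit at position $i$ of the binary representation of $n$, in decreasing order of height left to right, with leaves $h_1,\dots,h_n$ left to right. For either structure $\mathcal M$ and $1\le k\le n$, $\sigma_{\mathcal M}(k,n)$ is the height of the mountain containing $h_{n-k+1}$ (the number of hashes in its membership proof up to its peak), and $\bar\sigma_{\mathcal M}(k):=\lim_{N\to\infty}\frac1N\sum_{n=k}^{k+N-1}\sigma_{\mathcal M}(k,n)$. -}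

module Defs where

open import Data.Nat using (ℕ; zero; suc; _+_; _*_; _∸_; _^_; _≤?_; _≟_; NonZero)
open import Data.Nat.DivMod using (_/_; _%_)
open import Data.List using (List; []; _∷_; reverse)
open import Data.Integer as ℤ using (ℤ)
open import Data.Rational as ℚ using (ℚ)
open import Relation.Nullary using (yes; no)

-- A mountain list is represented by the list of its mountains' heights,
-- left to right; a mountain of height s carries 2^s consecutive leaves.

-- Height of the mountain containing leaf number j (1-based, from the left).
heightAt : List ℕ → ℕ → ℕ
heightAt [] j = 0
heightAt (h ∷ hs) j with j ≤? 2 ^ h
... | yes _ = h
... | no  _ = heightAt hs (j ∸ 2 ^ h)

-- Acting on the list read right-to-left: merge the first (= rightmost)
-- pair of consecutive equal heights, if any.
mergeRevFrom : ℕ → List ℕ → List ℕ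
mergeRevFrom a [] = a ∷ []
mergeRevFrom a (b ∷ rest) with a ≟ b
... | yes _ = suc a ∷ rest
... | no  _ = a ∷ mergeRevFrom b rest

mergeRev : List ℕ → List ℕ
mergeRev []       = []
mergeRev (a ∷ hs) = mergeRevFrom a hs

appendMMB : List ℕ → List ℕ
appendMMB hs = reverse (mergeRev (0 ∷ reverse hs))

mmb : ℕ → List ℕ
mmb zero    = []
mmb (suc n) = appendMMB (mmb n)

-- Positions of the 1-bits of m, shifted by i, in increasing order (fuel-bounded).
bitsFrom : ℕ → ℕ → ℕ → List ℕ
bitsFrom zero    i m = []
bitsFrom (suc f) i m with m % 2 ≟ 1
... | yes _ = i ∷ bitsFrom f (suc i) (m / 2)
... | no  _ = bitsFrom f (suc i) (m / 2)

-- U-MMR with n leaves: one mountain per 1-bit of n, decreasing heights.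
mmr : ℕ → List ℕ
mmr n = reverse (bitsFrom n 0 n)

-- σ(k,n): height of the mountain containing h_{n-k+1}

σMMB : ℕ → ℕ → ℕ
σMMB k n = heightAt (mmb n) (suc (n ∸ k))

σMMR : ℕ → ℕ → ℕ
σMMR k n = heightAt (mmr n) (suc (n ∸ k))

sumFrom : (ℕ → ℕ) → ℕ → ℕ → ℕ
sumFrom f k zero    = 0
sumFrom f k (suc N) = f k + sumFrom f (suc k) N

avgDiff : (k N : ℕ) → .{{NonZero N}} → ℚ
avgDiff k N =
  (ℤ.+ (sumFrom (σMMR k) k N) ℤ.- ℤ.+ (sumFrom (σMMB k) k N)) ℚ./ N

-- For fixed k write 2 ^ d ≤ k ≤ 2 ^ (d + 1) and k + 1 = 2 ^ (q + 1) + r with r < 2 ^ (q + 1).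
-- Counted from the right, the mountains of height at most e of the U-MMR with n leaves hold
-- n mod 2 ^ (e + 1) leaves, so σ_MMR(k, n) ≥ d + #{e ≥ d ∣ n mod 2 ^ (e + 1) < k}, whose average
-- over n is d + Σ_{e ≥ d} k / 2 ^ (e + 1) = d + k / 2 ^ d.  The U-MMB with n leaves is a binary
-- counter for n + 1: read from the right, position i holds a mountain of height i + bᵢ, where the
-- bᵢ are the binary digits of n + 1 below its leading 1.  Leaf k then lies at position q or q + 1,
-- so σ_MMB(k, n) is at most q plus three indicators of the residues of n + 1 modulo 2 ^ (q + 1)
-- and 2 ^ (q + 2), of average (3 r + 2 (2 ^ (q + 1) - max r 2 ^ q)) / 2 ^ (q + 2).  In each of the
-- cases r = 0, 0 < r ≤ 2 ^ q and 2 ^ q < r the two averages differ by at least 5/4 - 3/(2(k + 1)),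
-- and truncating the MMR count at T levels and averaging over N values of n costs
-- O(k / 2 ^ T + (T k + 2 ^ q) / N), which is below any ε for T and N large.

module Submission where

open import Defs
open import Data.Bool.Base using (Bool; true; false)
open import Data.List.Base using (List; []; _∷_; _++_; [_]; reverse; length)
open import Data.List.Properties using (reverse-involutive; unfold-reverse)
-- ℕ division is written ℕ./ so that _/_ can denote ℚ division in the statement of lemma26.
open import Data.Nat.Base hiding (_/_)
import Data.Nat.Base as ℕ
open import Data.Nat.DivMod hiding (_/_)
open import Data.Nat.Properties
open import Data.Nat.Tactic.RingSolver
open import Data.Product.Base using (∃-syntax; _×_; _,_; proj₂)
open import Data.Sum.Base using (inj₁; inj₂)
open import Function.Base using (_∘_)
open import Relation.Binary.PropositionalEquality hiding ([_])
open import Relation.Nullary.Decidable using (Dec; yes; no; _×-dec_; dec-yes; dec-no)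
open import Relation.Nullary.Negation using (¬_; contradiction)
open import Algebra.Properties.CommutativeSemigroup +-commutativeSemigroup
  using () renaming (interchange to +-interchange; xy∙z≈xz∙y to [m+n]+o≡[m+o]+n; xy∙z≈x∙zy to [m+n]+o≡m+[o+n])
open import Algebra.Properties.CommutativeSemigroup *-commutativeSemigroup
  using () renaming (x∙yz≈yx∙z to m*[n*o]≡[n*m]*o)

-- Finite sums

sumFrom-++ : ∀ f a M N → sumFrom f a (M + N) ≡ sumFrom f a M + sumFrom f (a + M) N
sumFrom-++ f a zero    N = cong (λ b → sumFrom f b N) (sym (+-identityʳ a))
sumFrom-++ f a (suc M) N rewrite sumFrom-++ f (suc a) M N | +-suc a M =
  sym (+-assoc (f a) _ _)

sumFrom-snoc : ∀ f a N → sumFrom f a (suc N) ≡ sumFrom f a N + f (a + N)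
sumFrom-snoc f a N = begin
  sumFrom f a (suc N)                        ≡⟨ cong (sumFrom f a) (+-comm 1 N) ⟩
  sumFrom f a (N + 1)                        ≡⟨ sumFrom-++ f a N 1 ⟩
  sumFrom f a N + (f (a + N) + 0)            ≡⟨ cong (sumFrom f a N +_) (+-identityʳ _) ⟩
  sumFrom f a N + f (a + N)                  ∎
  where open ≡-Reasoning

sumFrom-cong : ∀ {f g} a N → (∀ i → a ≤ i → i < a + N → f i ≡ g i) →
               sumFrom f a N ≡ sumFrom g a N
sumFrom-cong a zero    f≡g = refl
sumFrom-cong a (suc N) f≡g = cong₂ _+_ (f≡g a ≤-refl (m<m+n a z<s))
  (sumFrom-cong (suc a) N λ i a<i i<a+N → f≡g i (<⇒≤ a<i) (subst (i <_) (sym (+-suc a N)) i<a+N))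

sumFrom-mono : ∀ {f g} a N → (∀ i → a ≤ i → i < a + N → f i ≤ g i) →
               sumFrom f a N ≤ sumFrom g a N
sumFrom-mono a zero    f≤g = z≤n
sumFrom-mono a (suc N) f≤g = +-mono-≤ (f≤g a ≤-refl (m<m+n a z<s))
  (sumFrom-mono (suc a) N λ i a<i i<a+N → f≤g i (<⇒≤ a<i) (subst (i <_) (sym (+-suc a N)) i<a+N))

sumFrom-const : ∀ c a N → sumFrom (λ _ → c) a N ≡ N * c
sumFrom-const c a zero    = refl
sumFrom-const c a (suc N) = cong (c +_) (sumFrom-const c (suc a) N)

sumFrom-const-on : ∀ {f} c a N → (∀ i → a ≤ i → i < a + N → f i ≡ c) → sumFrom f a N ≡ N * c
sumFrom-const-on c a N f≡c = trans (sumFrom-cong a N f≡c) (sumFrom-const c a N)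

sumFrom-+ : ∀ f g a N → sumFrom (λ n → f n + g n) a N ≡ sumFrom f a N + sumFrom g a N
sumFrom-+ f g a zero    = refl
sumFrom-+ f g a (suc N) rewrite sumFrom-+ f g (suc a) N =
  +-interchange (f a) (g a) (sumFrom f (suc a) N) (sumFrom g (suc a) N)

sumFrom-suc : ∀ f a N → sumFrom (λ n → f (suc n)) a N ≡ sumFrom f (suc a) N
sumFrom-suc f a zero    = refl
sumFrom-suc f a (suc N) = cong (f (suc a) +_) (sumFrom-suc f (suc a) N)

sumFrom-+-suc₃ : ∀ c f g h a N → sumFrom (λ n → c + f (suc n) + g (suc n) + h (suc n)) a N ≡
                 N * c + sumFrom f (suc a) N + sumFrom g (suc a) N + sumFrom h (suc a) N
sumFrom-+-suc₃ c f g h a N = begin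
  sumFrom (λ n → c + f (suc n) + g (suc n) + h (suc n)) a N
    ≡⟨ sumFrom-+ (λ n → c + f (suc n) + g (suc n)) (h ∘ suc) a N ⟩
  sumFrom (λ n → c + f (suc n) + g (suc n)) a N + sumFrom (h ∘ suc) a N
    ≡⟨ cong (_+ sumFrom (h ∘ suc) a N) (sumFrom-+ (λ n → c + f (suc n)) (g ∘ suc) a N) ⟩
  sumFrom (λ n → c + f (suc n)) a N + sumFrom (g ∘ suc) a N + sumFrom (h ∘ suc) a N
    ≡⟨ cong (λ x → x + sumFrom (g ∘ suc) a N + sumFrom (h ∘ suc) a N) (sumFrom-+ (λ _ → c) (f ∘ suc) a N) ⟩
  sumFrom (λ _ → c) a N + sumFrom (f ∘ suc) a N + sumFrom (g ∘ suc) a N + sumFrom (h ∘ suc) a N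
    ≡⟨ cong₂ (λ x y → x + y + sumFrom (g ∘ suc) a N + sumFrom (h ∘ suc) a N) (sumFrom-const c a N) (sumFrom-suc f a N) ⟩
  N * c + sumFrom f (suc a) N + sumFrom (g ∘ suc) a N + sumFrom (h ∘ suc) a N
    ≡⟨ cong₂ (λ x y → N * c + sumFrom f (suc a) N + x + y) (sumFrom-suc g a N) (sumFrom-suc h a N) ⟩
  N * c + sumFrom f (suc a) N + sumFrom g (suc a) N + sumFrom h (suc a) N ∎
  where open ≡-Reasoning

sumFrom-comm : ∀ (H : ℕ → ℕ → ℕ) a N d T →
  sumFrom (λ n → sumFrom (λ e → H e n) d T) a N ≡ sumFrom (λ e → sumFrom (H e) a N) d T
sumFrom-comm H a N d zero    = trans (sumFrom-const 0 a N) (*-zeroʳ N)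
sumFrom-comm H a N d (suc T) = trans (sumFrom-+ (H d) (λ n → sumFrom (λ e → H e n) (suc d) T) a N)
  (cong (sumFrom (H d) a N +_) (sumFrom-comm H a N (suc d) T))

sumFrom-length-mono : ∀ f a {M N} → M ≤ N → sumFrom f a M ≤ sumFrom f a N
sumFrom-length-mono f a {M} M≤N with m≤n⇒∃[o]m+o≡n M≤N
... | o , refl = subst (sumFrom f a M ≤_) (sym (sumFrom-++ f a M o)) (m≤m+n _ _)

m<[1+m/n]*n : ∀ m n .{{_ : NonZero n}} → m < suc (m ℕ./ n) * n
m<[1+m/n]*n m n = begin-strict
  m                      ≡⟨ m≡m%n+[m/n]*n m n ⟩
  m % n + (m ℕ./ n) * n  <⟨ +-monoˡ-< _ (m%n<n m n) ⟩
  n + (m ℕ./ n) * n      ∎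
  where open ≤-Reasoning

Periodic : ℕ → (ℕ → ℕ) → Set
Periodic M g = ∀ n → g (n + M) ≡ g n

module _ {M g} .{{_ : NonZero M}} (g-periodic : Periodic M g) where

  sumFrom-period : ∀ a → sumFrom g a M ≡ sumFrom g 0 M
  sumFrom-period zero    = refl
  sumFrom-period (suc a) = +-cancelˡ-≡ (g a) _ _ (begin
    g a + sumFrom g (suc a) M  ≡⟨ sumFrom-snoc g a M ⟩
    sumFrom g a M + g (a + M)  ≡⟨ cong₂ _+_ (sumFrom-period a) (g-periodic a) ⟩
    sumFrom g 0 M + g a        ≡⟨ +-comm _ (g a) ⟩
    g a + sumFrom g 0 M        ∎)
    where open ≡-Reasoning

  sumFrom-periods : ∀ a q → sumFrom g a (q * M) ≡ q * sumFrom g 0 M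
  sumFrom-periods a zero    = refl
  sumFrom-periods a (suc q) = begin
    sumFrom g a (M + q * M)                        ≡⟨ sumFrom-++ g a M (q * M) ⟩
    sumFrom g a M + sumFrom g (a + M) (q * M)      ≡⟨ cong₂ _+_ (sumFrom-period a) (sumFrom-periods (a + M) q) ⟩
    sumFrom g 0 M + q * sumFrom g 0 M              ∎
    where open ≡-Reasoning

  -- A window of length N covers at least N / M and at most N / M + 1 whole periods.
  sumFrom-periodic-≤ : ∀ a N → M * sumFrom g a N ≤ (M + N) * sumFrom g 0 M
  sumFrom-periodic-≤ a N = begin
    M * sumFrom g a N              ≤⟨ *-monoʳ-≤ M (sumFrom-length-mono g a (<⇒≤ (m<[1+m/n]*n N M))) ⟩
    M * sumFrom g a (suc q * M)    ≡⟨ cong (M *_) (sumFrom-periods a (suc q)) ⟩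
    M * (suc q * S)                ≡⟨ m*[n*o]≡[n*m]*o M (suc q) S ⟩
    (suc q * M) * S                ≤⟨ *-monoˡ-≤ S (+-monoʳ-≤ M (m/n*n≤m N M)) ⟩
    (M + N) * S                    ∎
    where
    open ≤-Reasoning
    q = N ℕ./ M
    S = sumFrom g 0 M

  sumFrom-periodic-≥ : ∀ a N → N * sumFrom g 0 M ≤ M * (sumFrom g 0 M + sumFrom g a N)
  sumFrom-periodic-≥ a N = begin
    N * S                          ≤⟨ *-monoˡ-≤ S (<⇒≤ (m<[1+m/n]*n N M)) ⟩
    (suc q * M) * S                ≡⟨ m*[n*o]≡[n*m]*o M (suc q) S ⟨
    M * (S + q * S)                ≡⟨ cong (λ x → M * (S + x)) (sumFrom-periods a q) ⟨
    M * (S + sumFrom g a (q * M))  ≤⟨ *-monoʳ-≤ M (+-monoʳ-≤ S (sumFrom-length-mono g a (m/n*n≤m N M))) ⟩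
    M * (S + sumFrom g a N)        ∎
    where
    open ≤-Reasoning
    q = N ℕ./ M
    S = sumFrom g 0 M

%-periodic : ∀ f M .{{_ : NonZero M}} → Periodic M (λ n → f (n % M))
%-periodic f M n = cong f ([m+n]%n≡m%n n M)

sumFrom-% : ∀ f M .{{_ : NonZero M}} → sumFrom (λ n → f (n % M)) 0 M ≡ sumFrom f 0 M
sumFrom-% f M = sumFrom-cong 0 M λ i _ i<M → cong f (m<n⇒m%n≡m i<M)

𝟙 : ∀ {p} {P : Set p} → Dec P → ℕ
𝟙 (yes _) = 1
𝟙 (no _)  = 0

χ : ℕ → ℕ → ℕ → ℕ
χ a b x = 𝟙 (a ≤? x ×-dec x <? b)

χ-inside : ∀ {a b x} → a ≤ x → x < b → χ a b x ≡ 1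
χ-inside {a} {b} {x} a≤x x<b = cong 𝟙 (proj₂ (dec-yes (a ≤? x ×-dec x <? b) (a≤x , x<b)))

χ-outside : ∀ {a b x} → ¬ (a ≤ x × x < b) → χ a b x ≡ 0
χ-outside {a} {b} {x} ∉[a,b⟩ = cong 𝟙 (dec-no (a ≤? x ×-dec x <? b) ∉[a,b⟩)

χ-below : ∀ {a b x} → x < a → χ a b x ≡ 0
χ-below x<a = χ-outside λ (a≤x , _) → <⇒≱ x<a a≤x

χ-above : ∀ {a b x} → b ≤ x → χ a b x ≡ 0
χ-above b≤x = χ-outside λ (_ , x<b) → <⇒≱ x<b b≤x

χ-shift : ∀ {c k} y → c ≤ k → χ 0 k (c + y) ≡ χ 0 (k ∸ c) y
χ-shift {c} {k} y c≤k = by-cases (y <? k ∸ c)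
  where
  by-cases : Dec (y < k ∸ c) → χ 0 k (c + y) ≡ χ 0 (k ∸ c) y
  by-cases (yes y<k∸c) = trans (χ-inside z≤n (subst (c + y <_) (m+[n∸m]≡n c≤k) (+-monoʳ-< c y<k∸c)))
                               (sym (χ-inside z≤n y<k∸c))
  by-cases (no y≮k∸c)  = trans (χ-above (subst (_≤ c + y) (m+[n∸m]≡n c≤k) (+-monoʳ-≤ c (≮⇒≥ y≮k∸c))))
                               (sym (χ-above (≮⇒≥ y≮k∸c)))

sumFrom-χ : ∀ {a b M} → a ≤ b → b ≤ M → sumFrom (χ a b) 0 M ≡ b ∸ a
sumFrom-χ {a} {b} {M} a≤b b≤M = begin
  sumFrom (χ a b) 0 M                                              ≡⟨ cong (sumFrom (χ a b) 0) M≡ ⟨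
  sumFrom (χ a b) 0 (a + (b ∸ a + (M ∸ b)))                        ≡⟨ sumFrom-++ (χ a b) 0 a _ ⟩
  sumFrom (χ a b) 0 a + sumFrom (χ a b) a (b ∸ a + (M ∸ b))        ≡⟨ cong (sumFrom (χ a b) 0 a +_) (sumFrom-++ (χ a b) a (b ∸ a) _) ⟩
  sumFrom (χ a b) 0 a + (sumFrom (χ a b) a (b ∸ a) + sumFrom (χ a b) (a + (b ∸ a)) (M ∸ b))
    ≡⟨ cong₂ (λ x y → x + (sumFrom (χ a b) a (b ∸ a) + y)) below above ⟩
  0 + (sumFrom (χ a b) a (b ∸ a) + 0)                              ≡⟨ +-identityʳ _ ⟩
  sumFrom (χ a b) a (b ∸ a)                                        ≡⟨ inside ⟩
  b ∸ a                                                            ∎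
  where
  open ≡-Reasoning
  a+[b∸a]≡b : a + (b ∸ a) ≡ b
  a+[b∸a]≡b = m+[n∸m]≡n a≤b
  M≡ : a + (b ∸ a + (M ∸ b)) ≡ M
  M≡ = trans (sym (+-assoc a (b ∸ a) (M ∸ b))) (trans (cong (_+ (M ∸ b)) a+[b∸a]≡b) (m+[n∸m]≡n b≤M))
  below : sumFrom (χ a b) 0 a ≡ 0
  below = trans (sumFrom-const-on 0 0 a λ i _ i<a → χ-below i<a) (*-zeroʳ a)
  inside : sumFrom (χ a b) a (b ∸ a) ≡ b ∸ a
  inside = trans (sumFrom-const-on 1 a (b ∸ a) λ i a≤i i<b → χ-inside a≤i (subst (i <_) a+[b∸a]≡b i<b))
                 (*-identityʳ (b ∸ a))
  above : sumFrom (χ a b) (a + (b ∸ a)) (M ∸ b) ≡ 0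
  above = trans (sumFrom-const-on 0 (a + (b ∸ a)) (M ∸ b) λ i b≤i _ → χ-above (subst (_≤ i) a+[b∸a]≡b b≤i))
                (*-zeroʳ (M ∸ b))

module _ {a b M} .{{_ : NonZero M}} (a≤b : a ≤ b) (b≤M : b ≤ M) where

  private
    χ-mod-period : sumFrom (λ n → χ a b (n % M)) 0 M ≡ b ∸ a
    χ-mod-period = trans (sumFrom-% (χ a b) M) (sumFrom-χ a≤b b≤M)

  sumFrom-χ-%-≤ : ∀ s N → M * sumFrom (λ n → χ a b (n % M)) s N ≤ (M + N) * (b ∸ a)
  sumFrom-χ-%-≤ s N = subst (λ S → M * sumFrom (λ n → χ a b (n % M)) s N ≤ (M + N) * S) χ-mod-period
    (sumFrom-periodic-≤ (%-periodic (χ a b) M) s N)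

  sumFrom-χ-%-≥ : ∀ s N → N * (b ∸ a) ≤ M * (b ∸ a + sumFrom (λ n → χ a b (n % M)) s N)
  sumFrom-χ-%-≥ s N = subst (λ S → N * S ≤ M * (S + sumFrom (λ n → χ a b (n % M)) s N)) χ-mod-period
    (sumFrom-periodic-≥ (%-periodic (χ a b) M) s N)

-- Mountain lists

size : List ℕ → ℕ
size []       = 0
size (h ∷ hs) = 2 ^ h + size hs

size-++ : ∀ xs ys → size (xs ++ ys) ≡ size xs + size ys
size-++ []       ys = refl
size-++ (x ∷ xs) ys = trans (cong (2 ^ x +_) (size-++ xs ys)) (sym (+-assoc (2 ^ x) _ _))

size-reverse : ∀ xs → size (reverse xs) ≡ size xs
size-reverse []       = refl
size-reverse (x ∷ xs) = begin
  size (reverse (x ∷ xs))         ≡⟨ cong size (unfold-reverse x xs) ⟩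
  size (reverse xs ++ [ x ])      ≡⟨ size-++ (reverse xs) [ x ] ⟩
  size (reverse xs) + (2 ^ x + 0) ≡⟨ cong₂ _+_ (size-reverse xs) (+-identityʳ (2 ^ x)) ⟩
  size xs + 2 ^ x                 ≡⟨ +-comm (size xs) (2 ^ x) ⟩
  2 ^ x + size xs                 ∎
  where open ≡-Reasoning

heightAt-head : ∀ {h j} hs → j ≤ 2 ^ h → heightAt (h ∷ hs) j ≡ h
heightAt-head {h} {j} hs j≤2^h with j ≤? 2 ^ h
... | yes _    = refl
... | no j≰2^h = contradiction j≤2^h j≰2^h

heightAt-tail : ∀ {h j} hs → 2 ^ h < j → heightAt (h ∷ hs) j ≡ heightAt hs (j ∸ 2 ^ h)
heightAt-tail {h} {j} hs 2^h<j with j ≤? 2 ^ h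
... | yes j≤2^h = contradiction j≤2^h (<⇒≱ 2^h<j)
... | no _      = refl

heightAt-++ˡ : ∀ xs ys {j} → 1 ≤ j → j ≤ size xs → heightAt (xs ++ ys) j ≡ heightAt xs j
heightAt-++ˡ []       ys (s≤s _) ()
heightAt-++ˡ (x ∷ xs) ys {j} 1≤j j≤ with j ≤? 2 ^ x
... | yes _    = refl
... | no j≰2^x = heightAt-++ˡ xs ys (m<n⇒0<n∸m (≰⇒> j≰2^x))
  (subst (j ∸ 2 ^ x ≤_) (m+n∸m≡n (2 ^ x) (size xs)) (∸-monoˡ-≤ (2 ^ x) j≤))

heightAt-++ʳ : ∀ xs ys {j} → size xs < j → heightAt (xs ++ ys) j ≡ heightAt ys (j ∸ size xs)
heightAt-++ʳ []       ys     _    = refl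
heightAt-++ʳ (x ∷ xs) ys {j} j>  = begin
  heightAt (x ∷ xs ++ ys) j                 ≡⟨ heightAt-tail (xs ++ ys) (≤-<-trans (m≤m+n (2 ^ x) (size xs)) j>) ⟩
  heightAt (xs ++ ys) (j ∸ 2 ^ x)           ≡⟨ heightAt-++ʳ xs ys (subst (_< j ∸ 2 ^ x) (m+n∸m≡n (2 ^ x) (size xs))
                                                 (∸-monoˡ-< j> (m≤m+n (2 ^ x) (size xs)))) ⟩
  heightAt ys (j ∸ 2 ^ x ∸ size xs)         ≡⟨ cong (heightAt ys) (∸-+-assoc j (2 ^ x) (size xs)) ⟩
  heightAt ys (j ∸ (2 ^ x + size xs))       ∎
  where open ≡-Reasoning

heightAt-reverse : ∀ hs {k} → 1 ≤ k → k ≤ size hs →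
                   heightAt (reverse hs) (suc (size hs ∸ k)) ≡ heightAt hs k
heightAt-reverse []       (s≤s _) ()
heightAt-reverse (x ∷ xs) {k} 1≤k k≤ with k ≤? 2 ^ x
... | yes k≤2^x = begin
  heightAt (reverse (x ∷ xs)) (suc (2 ^ x + S ∸ k))     ≡⟨ cong₂ heightAt (unfold-reverse x xs) (cong suc (+-∸-comm S k≤2^x)) ⟩
  heightAt (reverse xs ++ [ x ]) (suc (2 ^ x ∸ k + S))
    ≡⟨ heightAt-++ʳ (reverse xs) [ x ] (s≤s (subst (_≤ 2 ^ x ∸ k + S) (sym (size-reverse xs)) (m≤n+m S _))) ⟩
  heightAt [ x ] (suc (2 ^ x ∸ k + S) ∸ size (reverse xs)) ≡⟨ heightAt-head [] fits ⟩
  x                                                     ∎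
  where
  open ≡-Reasoning
  S = size xs
  fits : suc (2 ^ x ∸ k + S) ∸ size (reverse xs) ≤ 2 ^ x
  fits rewrite size-reverse xs | m+n∸n≡m (suc (2 ^ x ∸ k)) S = ∸-monoʳ-< 1≤k k≤2^x
... | no k≰2^x with m≤n⇒∃[o]m+o≡n (<⇒≤ (≰⇒> k≰2^x))
... | k′ , refl = begin
  heightAt (reverse (x ∷ xs)) (suc (2 ^ x + S ∸ (2 ^ x + k′)))  ≡⟨ cong₂ heightAt (unfold-reverse x xs) (cong suc ([m+n]∸[m+o]≡n∸o (2 ^ x) S k′)) ⟩
  heightAt (reverse xs ++ [ x ]) (suc (S ∸ k′))
    ≡⟨ heightAt-++ˡ (reverse xs) [ x ] (s≤s z≤n) (subst (suc (S ∸ k′) ≤_) (sym (size-reverse xs)) S∸k′<S) ⟩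
  heightAt (reverse xs) (suc (S ∸ k′))                        ≡⟨ heightAt-reverse xs 1≤k′ k′≤S ⟩
  heightAt xs k′                                              ≡⟨ cong (heightAt xs) (m+n∸m≡n (2 ^ x) k′) ⟨
  heightAt xs (2 ^ x + k′ ∸ 2 ^ x)                            ∎
  where
  open ≡-Reasoning
  S = size xs
  1≤k′ : 1 ≤ k′
  1≤k′ = +-cancelˡ-< (2 ^ x) 0 k′ (subst (_< 2 ^ x + k′) (sym (+-identityʳ _)) (≰⇒> k≰2^x))
  k′≤S : k′ ≤ S
  k′≤S = +-cancelˡ-≤ (2 ^ x) _ _ k≤
  S∸k′<S : S ∸ k′ < S
  S∸k′<S = ∸-monoʳ-< 1≤k′ k′≤S

-- Residues modulo powers of two

_%2^_ : ℕ → ℕ → ℕ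
m %2^ j = _%_ m (2 ^ j) {{m^n≢0 2 j}}

%2^-< : ∀ m j → m %2^ j < 2 ^ j
%2^-< m j = m%n<n m (2 ^ j) {{m^n≢0 2 j}}

m≡m%2+2*[m/2] : ∀ m → m ≡ m % 2 + 2 * (m ℕ./ 2)
m≡m%2+2*[m/2] m = trans (m≡m%n+[m/n]*n m 2) (cong (m % 2 +_) (*-comm (m ℕ./ 2) 2))

%2≢1⇒%2≡0 : ∀ m → m % 2 ≢ 1 → m % 2 ≡ 0
%2≢1⇒%2≡0 m m%2≢1 with n≤1⇒n≡0∨n≡1 (≤-pred (m%n<n m 2))
... | inj₁ m%2≡0 = m%2≡0
... | inj₂ m%2≡1 = contradiction m%2≡1 m%2≢1

%2≤1 : ∀ m → m % 2 ≤ 1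
%2≤1 m = ≤-pred (m%n<n m 2)

m*[n+2o]≡m*n+2m*o : ∀ m n o → m * (n + 2 * o) ≡ m * n + 2 * m * o
m*[n+2o]≡m*n+2m*o m n o = trans (*-distribˡ-+ m n (2 * o)) (cong (m * n +_) (m*[n*o]≡[n*m]*o m 2 o))

*-halve : ∀ p m → p * m ≡ p * (m % 2) + 2 * p * (m ℕ./ 2)
*-halve p m = trans (cong (p *_) (m≡m%2+2*[m/2] m)) (m*[n+2o]≡m*n+2m*o p (m % 2) (m ℕ./ 2))

%2^-suc : ∀ m j → m %2^ suc j ≡ m % 2 + 2 * ((m ℕ./ 2) %2^ j)
%2^-suc m j = trans (cong (_%2^ suc j) m≡)
  (trans ([m+kn]%n≡m%n low ((m ℕ./ 2) ℕ./ X) (2 * X)) (m<n⇒m%n≡m low<2X))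
  where
  instance
    _ = m^n≢0 2 j
    _ = m^n≢0 2 (suc j)
  X = 2 ^ j
  low = m % 2 + 2 * ((m ℕ./ 2) % X)
  regroup : ∀ a b c X → a + (b + c * X) * 2 ≡ (a + 2 * b) + c * (2 * X)
  regroup = solve-∀
  m≡ : m ≡ low + ((m ℕ./ 2) ℕ./ X) * (2 * X)
  m≡ = begin
    m                                          ≡⟨ m≡m%n+[m/n]*n m 2 ⟩
    m % 2 + (m ℕ./ 2) * 2                        ≡⟨ cong (λ x → m % 2 + x * 2) (m≡m%n+[m/n]*n (m ℕ./ 2) X) ⟩
    m % 2 + ((m ℕ./ 2) % X + ((m ℕ./ 2) ℕ./ X) * X) * 2 ≡⟨ regroup (m % 2) ((m ℕ./ 2) % X) ((m ℕ./ 2) ℕ./ X) X ⟩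
    low + ((m ℕ./ 2) ℕ./ X) * (2 * X)              ∎
    where open ≡-Reasoning
  low<2X : low < 2 * X
  low<2X = begin-strict
    m % 2 + 2 * ((m ℕ./ 2) % X)  <⟨ s≤s (+-monoˡ-≤ _ (%2≤1 m)) ⟩
    2 + 2 * ((m ℕ./ 2) % X)      ≡⟨ *-suc 2 _ ⟨
    2 * suc ((m ℕ./ 2) % X)      ≤⟨ *-monoʳ-≤ 2 (m%n<n (m ℕ./ 2) X) ⟩
    2 * X                      ∎
    where open ≤-Reasoning

%2^-+* : ∀ {y} j c → y < 2 ^ j → (y + c * 2 ^ j) %2^ j ≡ y
%2^-+* {y} j c y<2^j = trans ([m+kn]%n≡m%n y c (2 ^ j)) (m<n⇒m%n≡m y<2^j)
  where instance _ = m^n≢0 2 j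

%2^-suc-+* : ∀ {y} j c → y < 2 ^ j → (y + c * 2 ^ j) %2^ suc j ≡ y + 2 ^ j * (c % 2)
%2^-suc-+* {y} j c y<2^j = begin
  (y + c * X) %2^ suc j                              ≡⟨ cong (λ d → (y + d * X) %2^ suc j) (m≡m%n+[m/n]*n c 2) ⟩
  (y + (c % 2 + (c ℕ./ 2) * 2) * X) %2^ suc j          ≡⟨ cong (_%2^ suc j) (regroup y (c % 2) (c ℕ./ 2) X) ⟩
  (y + X * (c % 2) + (c ℕ./ 2) * (2 * X)) %2^ suc j    ≡⟨ [m+kn]%n≡m%n (y + X * (c % 2)) (c ℕ./ 2) (2 * X) ⟩
  (y + X * (c % 2)) %2^ suc j                        ≡⟨ m<n⇒m%n≡m low<2X ⟩
  y + X * (c % 2)                                    ∎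
  where
  open ≡-Reasoning
  instance _ = m^n≢0 2 (suc j)
  X = 2 ^ j
  regroup : ∀ y a b X → y + (a + b * 2) * X ≡ y + X * a + b * (2 * X)
  regroup = solve-∀
  low<2X : y + X * (c % 2) < 2 * X
  low<2X = subst (y + X * (c % 2) <_) (cong (X +_) (sym (+-identityʳ X)))
    (+-mono-<-≤ y<2^j (≤-trans (*-monoʳ-≤ X (%2≤1 c)) (≤-reflexive (*-identityʳ X))))

-- The U-MMB as a binary counter

bit : Bool → ℕ
bit false = 0
bit true  = 1

bit≤1 : ∀ b → bit b ≤ 1
bit≤1 false = z≤n
bit≤1 true  = ≤-refl

value : List Bool → ℕ
value []       = 0
value (b ∷ bs) = bit b + 2 * value bs

-- bs lists the binary digits of value₁ bs below its leading 1, least significant first.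
value₁ : List Bool → ℕ
value₁ bs = value bs + 2 ^ length bs

increment : List Bool → List Bool
increment []           = false ∷ []
increment (false ∷ bs) = true ∷ bs
increment (true ∷ bs)  = false ∷ increment bs

counter : ℕ → List Bool
counter zero    = []
counter (suc n) = increment (counter n)

-- Read right to left, the U-MMB with n leaves has a mountain of height i + bᵢ at each
-- position i, where the bᵢ are the digits of counter n (so value₁ (counter n) = n + 1).
mountainsFrom : ℕ → List Bool → List ℕ
mountainsFrom s []       = []
mountainsFrom s (b ∷ bs) = bit b + s ∷ mountainsFrom (suc s) bs

mergeRevFrom-increment : ∀ s bs → mergeRevFrom s (mountainsFrom s bs) ≡ mountainsFrom s (increment bs)
mergeRevFrom-increment s []           = refl
mergeRevFrom-increment s (false ∷ bs) with s ≟ s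
... | yes _   = refl
... | no s≢s  = contradiction refl s≢s
mergeRevFrom-increment s (true ∷ bs) with s ≟ suc s
... | yes s≡1+s = contradiction (sym s≡1+s) 1+n≢n
... | no _      = cong (s ∷_) (mergeRevFrom-increment (suc s) bs)

mmb≡reverse-mountainsFrom : ∀ n → mmb n ≡ reverse (mountainsFrom 0 (counter n))
mmb≡reverse-mountainsFrom zero    = refl
mmb≡reverse-mountainsFrom (suc n) = cong reverse (begin
  mergeRevFrom 0 (reverse (mmb n))                                ≡⟨ cong (mergeRevFrom 0 ∘ reverse) (mmb≡reverse-mountainsFrom n) ⟩
  mergeRevFrom 0 (reverse (reverse (mountainsFrom 0 (counter n)))) ≡⟨ cong (mergeRevFrom 0) (reverse-involutive (mountainsFrom 0 (counter n))) ⟩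
  mergeRevFrom 0 (mountainsFrom 0 (counter n))                    ≡⟨ mergeRevFrom-increment 0 (counter n) ⟩
  mountainsFrom 0 (counter (suc n))                               ∎)
  where open ≡-Reasoning

value₁-∷ : ∀ b bs → value₁ (b ∷ bs) ≡ bit b + 2 * value₁ bs
value₁-∷ b bs = trans (+-assoc (bit b) _ _) (cong (bit b +_) (sym (*-distribˡ-+ 2 (value bs) _)))

value₁-increment : ∀ bs → value₁ (increment bs) ≡ suc (value₁ bs)
value₁-increment []           = refl
value₁-increment (false ∷ bs) = trans (value₁-∷ true bs) (cong suc (sym (value₁-∷ false bs)))
value₁-increment (true ∷ bs)  = begin
  value₁ (false ∷ increment bs)  ≡⟨ value₁-∷ false (increment bs) ⟩
  2 * value₁ (increment bs)      ≡⟨ cong (2 *_) (value₁-increment bs) ⟩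
  2 * suc (value₁ bs)            ≡⟨ *-suc 2 (value₁ bs) ⟩
  2 + 2 * value₁ bs              ≡⟨ cong suc (value₁-∷ true bs) ⟨
  suc (value₁ (true ∷ bs))       ∎
  where open ≡-Reasoning

value₁-counter : ∀ n → value₁ (counter n) ≡ suc n
value₁-counter zero    = refl
value₁-counter (suc n) = trans (value₁-increment (counter n)) (cong suc (value₁-counter n))

2^[b+s]+2^s≡2^s*b+2^[1+s] : ∀ b s → 2 ^ (bit b + s) + 2 ^ s ≡ 2 ^ s * bit b + 2 ^ suc s
2^[b+s]+2^s≡2^s*b+2^[1+s] false s = trans (cong (2 ^ s +_) (sym (+-identityʳ (2 ^ s)))) (cong (_+ 2 ^ suc s) (sym (*-zeroʳ (2 ^ s))))
2^[b+s]+2^s≡2^s*b+2^[1+s] true  s = trans (+-comm (2 ^ suc s) (2 ^ s)) (cong (_+ 2 ^ suc s) (sym (*-identityʳ (2 ^ s))))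

size-mountainsFrom : ∀ s bs → size (mountainsFrom s bs) + 2 ^ s ≡ 2 ^ s * value₁ bs
size-mountainsFrom s []       = sym (*-identityʳ (2 ^ s))
size-mountainsFrom s (b ∷ bs) = begin
  (2 ^ (bit b + s) + R) + 2 ^ s        ≡⟨ [m+n]+o≡[m+o]+n (2 ^ (bit b + s)) R (2 ^ s) ⟩
  (2 ^ (bit b + s) + 2 ^ s) + R        ≡⟨ cong (_+ R) (2^[b+s]+2^s≡2^s*b+2^[1+s] b s) ⟩
  (2 ^ s * bit b + 2 ^ suc s) + R      ≡⟨ [m+n]+o≡m+[o+n] (2 ^ s * bit b) (2 ^ suc s) R ⟩
  2 ^ s * bit b + (R + 2 ^ suc s)      ≡⟨ cong (2 ^ s * bit b +_) (size-mountainsFrom (suc s) bs) ⟩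
  2 ^ s * bit b + (2 * 2 ^ s) * V      ≡⟨ cong (2 ^ s * bit b +_) (m*[n*o]≡[n*m]*o (2 ^ s) 2 V) ⟨
  2 ^ s * bit b + 2 ^ s * (2 * V)      ≡⟨ *-distribˡ-+ (2 ^ s) (bit b) (2 * V) ⟨
  2 ^ s * (bit b + 2 * V)              ≡⟨ cong (2 ^ s *_) (value₁-∷ b bs) ⟨
  2 ^ s * value₁ (b ∷ bs)              ∎
  where
  open ≡-Reasoning
  R = size (mountainsFrom (suc s) bs)
  V = value₁ bs

size-mountainsFrom-0 : ∀ bs → suc (size (mountainsFrom 0 bs)) ≡ value₁ bs
size-mountainsFrom-0 bs = trans (+-comm 1 _) (trans (size-mountainsFrom 0 bs) (*-identityˡ _))

σMMB≡heightAt-mountainsFrom : ∀ {k n} → 1 ≤ k → k ≤ n → σMMB k n ≡ heightAt (mountainsFrom 0 (counter n)) k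
σMMB≡heightAt-mountainsFrom {k} {n} 1≤k k≤n = begin
  heightAt (mmb n) (suc (n ∸ k))            ≡⟨ cong₂ (λ hs m → heightAt hs (suc (m ∸ k))) (mmb≡reverse-mountainsFrom n) (sym size≡n) ⟩
  heightAt (reverse hs) (suc (size hs ∸ k)) ≡⟨ heightAt-reverse hs 1≤k (subst (k ≤_) (sym size≡n) k≤n) ⟩
  heightAt hs k                             ∎
  where
  open ≡-Reasoning
  hs = mountainsFrom 0 (counter n)
  size≡n : size hs ≡ n
  size≡n = suc-injective (trans (size-mountainsFrom-0 (counter n)) (value₁-counter n))

value-< : ∀ bs → value bs < 2 ^ length bs
value-< []       = s≤s z≤n
value-< (b ∷ bs) = begin-strict
  bit b + 2 * value bs  <⟨ s≤s (+-monoˡ-≤ _ (bit≤1 b)) ⟩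
  2 + 2 * value bs      ≡⟨ *-suc 2 (value bs) ⟨
  2 * suc (value bs)    ≤⟨ *-monoʳ-≤ 2 (value-< bs) ⟩
  2 * 2 ^ length bs     ∎
  where open ≤-Reasoning

value₁-< : ∀ bs → value₁ bs < 2 ^ suc (length bs)
value₁-< bs = subst (value₁ bs <_) (cong (2 ^ length bs +_) (sym (+-identityʳ _)))
  (+-monoˡ-< (2 ^ length bs) (value-< bs))

value₁-++ : ∀ xs ys → value₁ (xs ++ ys) ≡ value xs + 2 ^ length xs * value₁ ys
value₁-++ []       ys = sym (*-identityˡ (value₁ ys))
value₁-++ (x ∷ xs) ys = begin
  value₁ (x ∷ xs ++ ys)                                  ≡⟨ value₁-∷ x (xs ++ ys) ⟩
  bit x + 2 * value₁ (xs ++ ys)                          ≡⟨ cong (λ v → bit x + 2 * v) (value₁-++ xs ys) ⟩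
  bit x + 2 * (value xs + 2 ^ length xs * value₁ ys)     ≡⟨ cong (bit x +_) (*-distribˡ-+ 2 (value xs) _) ⟩
  bit x + (2 * value xs + 2 * (2 ^ length xs * value₁ ys)) ≡⟨ +-assoc (bit x) _ _ ⟨
  value (x ∷ xs) + 2 * (2 ^ length xs * value₁ ys)       ≡⟨ cong (value (x ∷ xs) +_) (*-assoc 2 (2 ^ length xs) (value₁ ys)) ⟨
  value (x ∷ xs) + 2 ^ length (x ∷ xs) * value₁ ys       ∎
  where open ≡-Reasoning

value₁-∷-%2 : ∀ b bs → value₁ (b ∷ bs) % 2 ≡ bit b
value₁-∷-%2 b bs = begin
  value₁ (b ∷ bs) % 2             ≡⟨ cong (_% 2) (trans (value₁-∷ b bs) (cong (bit b +_) (*-comm 2 (value₁ bs)))) ⟩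
  (bit b + value₁ bs * 2) % 2     ≡⟨ [m+kn]%n≡m%n (bit b) (value₁ bs) 2 ⟩
  bit b % 2                       ≡⟨ bit%2 b ⟩
  bit b                           ∎
  where
  open ≡-Reasoning
  bit%2 : ∀ b → bit b % 2 ≡ bit b
  bit%2 false = refl
  bit%2 true  = refl

mountainsFrom-++ : ∀ s xs ys → mountainsFrom s (xs ++ ys) ≡ mountainsFrom s xs ++ mountainsFrom (s + length xs) ys
mountainsFrom-++ s []       ys = cong (λ t → mountainsFrom t ys) (sym (+-identityʳ s))
mountainsFrom-++ s (x ∷ xs) ys = cong (bit x + s ∷_)
  (trans (mountainsFrom-++ (suc s) xs ys) (cong (λ t → mountainsFrom (suc s) xs ++ mountainsFrom t ys) (sym (+-suc s (length xs)))))

split-at : ∀ {A : Set} q (xs : List A) → q < length xs →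
           ∃[ pre ] ∃[ x ] ∃[ post ] (xs ≡ pre ++ x ∷ post × length pre ≡ q)
split-at zero    (x ∷ xs) _         = [] , x , xs , refl , refl
split-at (suc q) (y ∷ xs) (s≤s q<) with split-at q xs q<
... | pre , x , post , refl , refl = y ∷ pre , x , post , refl , refl

-- With k + 1 = 2 ^ (q + 1) + r and y, z the residues of n + 1 modulo 2 ^ (q + 1), 2 ^ (q + 2):
-- leaf k from the right of the U-MMB lies in the mountain at position q, of height q + b_q,
-- unless y < r, when it lies in the next one, of height q + 1 + b_(q+1).
mmbBound : (q r y z : ℕ) → ℕ
mmbBound q r y z = q + χ 0 r y + χ (r ⊔ 2 ^ q) (2 ^ suc q) y + χ (2 ^ suc q) (2 ^ suc q + r) z

-- Leaf k of a list of mountains whose first one has size H, where k + v = P + r and H + v = P + y.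
module _ {k v P r} (k+v≡P+r : k + v ≡ P + r) where

  past-head⇒< : ∀ {H y} → H + v ≡ P + y → H < k → y < r
  past-head⇒< {H} {y} H+v≡P+y H<k = +-cancelˡ-< P y r (begin-strict
    P + y  ≡⟨ H+v≡P+y ⟨
    H + v  <⟨ +-monoˡ-< v H<k ⟩
    k + v  ≡⟨ k+v≡P+r ⟩
    P + r  ∎)
    where open ≤-Reasoning

  in-head⇒≤ : ∀ {H y} → H + v ≡ P + y → k ≤ H → r ≤ y
  in-head⇒≤ {H} {y} H+v≡P+y k≤H = +-cancelˡ-≤ P r y (begin
    P + r  ≡⟨ k+v≡P+r ⟨
    k + v  ≤⟨ +-monoˡ-≤ v k≤H ⟩
    H + v  ≡⟨ H+v≡P+y ⟩
    P + y  ∎)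
    where open ≤-Reasoning

  past-head-∸-≤ : ∀ {H} → P ≤ H → k ∸ H ≤ r
  past-head-∸-≤ {H} P≤H = begin
    k ∸ H      ≤⟨ ∸-monoʳ-≤ k P≤H ⟩
    k ∸ P      ≤⟨ ∸-monoˡ-≤ P (subst (k ≤_) k+v≡P+r (m≤m+n k v)) ⟩
    P + r ∸ P  ≡⟨ m+n∸m≡n P r ⟩
    r          ∎
    where open ≤-Reasoning

q≤mmbBound : ∀ q r y z → q ≤ mmbBound q r y z
q≤mmbBound q r y z = ≤-trans (m≤m+n q _) (≤-trans (m≤m+n _ _) (m≤m+n _ _))

next-mountain≤mmbBound : ∀ q {r y t} → y < r → t ≤ 1 → suc q + t ≤ mmbBound q r y (y + 2 ^ suc q * t)
next-mountain≤mmbBound q {r} {y} {t} y<r t≤1 = begin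
  suc q + t                           ≡⟨ cong (_+ t) (trans (+-comm 1 q) (cong (q +_) (sym (χ-inside z≤n y<r)))) ⟩
  q + χ 0 r y + t                     ≤⟨ +-mono-≤ (m≤m+n (q + χ 0 r y) _) (t≤χ t t≤1) ⟩
  mmbBound q r y (y + 2 ^ suc q * t)  ∎
  where
  open ≤-Reasoning
  Q = 2 ^ suc q
  t≤χ : ∀ t → t ≤ 1 → t ≤ χ Q (Q + r) (y + Q * t)
  t≤χ zero    _ = z≤n
  t≤χ (suc (suc _)) (s≤s ())
  t≤χ (suc zero) _ = ≤-reflexive (sym (χ-inside (subst (Q ≤_) y+Q≡ (m≤n+m Q y))
                                                (subst (_< Q + r) (trans (+-comm Q y) y+Q≡) (+-monoʳ-< Q y<r))))
    where
    y+Q≡ : y + Q ≡ y + Q * 1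
    y+Q≡ = cong (y +_) (sym (*-identityʳ Q))

heightAt-next-mountain-≤ : ∀ q rest {ℓ} → ℓ < 2 ^ suc q → heightAt (mountainsFrom (suc q) rest) ℓ ≤ suc q + value₁ rest % 2
heightAt-next-mountain-≤ q []       _  = z≤n
heightAt-next-mountain-≤ q (c ∷ cs) {ℓ} ℓ< = ≤-reflexive (begin
  heightAt (bit c + suc q ∷ mountainsFrom (suc (suc q)) cs) ℓ
    ≡⟨ heightAt-head {bit c + suc q} _ (≤-trans (<⇒≤ ℓ<) (^-monoʳ-≤ 2 (m≤n+m (suc q) (bit c)))) ⟩
  bit c + suc q                                              ≡⟨ +-comm (bit c) (suc q) ⟩
  suc q + bit c                                              ≡⟨ cong (suc q +_) (value₁-∷-%2 c cs) ⟨
  suc q + value₁ (c ∷ cs) % 2                                ∎)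
  where open ≡-Reasoning

heightAt-mountainsFrom-∷-≤ : ∀ q b rest {r k v} → v < 2 ^ q → k + v ≡ 2 ^ q + r → r < 2 ^ suc q →
  heightAt (mountainsFrom q (b ∷ rest)) k ≤
  mmbBound q r (v + 2 ^ q * bit b) (v + 2 ^ q * bit b + 2 ^ suc q * (value₁ rest % 2))
heightAt-mountainsFrom-∷-≤ q b rest {r} {k} {v} v<P k+v≡P+r r<Q = by-bit b
  where
  P = 2 ^ q
  Q = 2 ^ suc q
  t = value₁ rest % 2
  in-next-mountain : ∀ {H y} → P ≤ H → H + v ≡ P + y → H < k →
             heightAt (mountainsFrom (suc q) rest) (k ∸ H) ≤ mmbBound q r y (y + Q * t)
  in-next-mountain P≤H H+v≡P+y H<k = ≤-trans (heightAt-next-mountain-≤ q rest (≤-<-trans (past-head-∸-≤ k+v≡P+r P≤H) r<Q))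
    (next-mountain≤mmbBound q (past-head⇒< k+v≡P+r H+v≡P+y H<k) (%2≤1 (value₁ rest)))
  by-bit : ∀ b → heightAt (mountainsFrom q (b ∷ rest)) k ≤ mmbBound q r (v + P * bit b) (v + P * bit b + Q * t)
  by-bit false = by-cases (k ≤? P)
    where
    P+v≡ : P + v ≡ P + (v + P * 0)
    P+v≡ = cong (P +_) (sym (trans (cong (v +_) (*-zeroʳ P)) (+-identityʳ v)))
    by-cases : Dec (k ≤ P) → heightAt (q ∷ mountainsFrom (suc q) rest) k ≤ mmbBound q r (v + P * 0) (v + P * 0 + Q * t)
    by-cases (yes k≤P) = ≤-trans (≤-reflexive (heightAt-head {q} _ k≤P)) (q≤mmbBound q r _ _)
    by-cases (no k≰P)  = ≤-trans (≤-reflexive (heightAt-tail {q} _ (≰⇒> k≰P))) (in-next-mountain ≤-refl P+v≡ (≰⇒> k≰P))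
  by-bit true = by-cases (k ≤? Q)
    where
    y = v + P * 1
    Q+v≡ : Q + v ≡ P + y
    Q+v≡ = trans ([m+n]+o≡m+[o+n] P (P + 0) v) (cong (λ x → P + (v + x)) (trans (+-identityʳ P) (sym (*-identityʳ P))))
    P≤y : P ≤ y
    P≤y = subst (P ≤_) (cong (v +_) (sym (*-identityʳ P))) (m≤n+m P v)
    y<Q : y < Q
    y<Q = subst₂ _<_ (cong (v +_) (sym (*-identityʳ P))) (cong (P +_) (sym (+-identityʳ P))) (+-monoˡ-< P v<P)
    by-cases : Dec (k ≤ Q) → heightAt (suc q ∷ mountainsFrom (suc q) rest) k ≤ mmbBound q r y (y + Q * t)
    by-cases (yes k≤Q) = ≤-trans (≤-reflexive (heightAt-head {suc q} _ k≤Q)) (begin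
      suc q                          ≡⟨ +-comm 1 q ⟩
      q + 1                          ≤⟨ +-monoˡ-≤ 1 (m≤m+n q _) ⟩
      q + χ 0 r y + 1
        ≡⟨ cong (q + χ 0 r y +_) (χ-inside (⊔-lub (in-head⇒≤ k+v≡P+r Q+v≡ k≤Q) P≤y) y<Q) ⟨
      q + χ 0 r y + χ (r ⊔ P) Q y    ≤⟨ m≤m+n _ _ ⟩
      mmbBound q r y (y + Q * t)     ∎)
      where open ≤-Reasoning
    by-cases (no k≰Q)  = ≤-trans (≤-reflexive (heightAt-tail {suc q} _ (≰⇒> k≰Q))) (in-next-mountain (m≤m+n P _) Q+v≡ (≰⇒> k≰Q))

2^[1+q]≤value₁⇒q<length : ∀ {q} bs → 2 ^ suc q ≤ value₁ bs → q < length bs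
2^[1+q]≤value₁⇒q<length {q} bs 2^[1+q]≤V = ≰⇒> λ length≤q → <-irrefl refl (begin-strict
  value₁ bs            <⟨ value₁-< bs ⟩
  2 ^ suc (length bs)  ≤⟨ ^-monoʳ-≤ 2 (s≤s length≤q) ⟩
  2 ^ suc q            ≤⟨ 2^[1+q]≤V ⟩
  value₁ bs            ∎)
  where open ≤-Reasoning

value₁-++-∷ : ∀ pre b rest → let P = 2 ^ length pre in
              value₁ (pre ++ b ∷ rest) ≡ (value pre + P * bit b) + value₁ rest * (2 * P)
value₁-++-∷ pre b rest = begin
  value₁ (pre ++ b ∷ rest)                ≡⟨ value₁-++ pre (b ∷ rest) ⟩
  v + P * value₁ (b ∷ rest)               ≡⟨ cong (λ x → v + P * x) (value₁-∷ b rest) ⟩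
  v + P * (bit b + 2 * V)                 ≡⟨ cong (v +_) (m*[n+2o]≡m*n+2m*o P (bit b) V) ⟩
  v + (P * bit b + 2 * P * V)             ≡⟨ +-assoc v _ _ ⟨
  (v + P * bit b) + 2 * P * V             ≡⟨ cong (v + P * bit b +_) (*-comm (2 * P) V) ⟩
  (v + P * bit b) + V * (2 * P)           ∎
  where
  open ≡-Reasoning
  v = value pre
  P = 2 ^ length pre
  V = value₁ rest

value+2^length*bit-< : ∀ pre b → value pre + 2 ^ length pre * bit b < 2 ^ suc (length pre)
value+2^length*bit-< pre b = subst (value pre + P * bit b <_) (cong (P +_) (sym (+-identityʳ P)))
  (+-mono-<-≤ (value-< pre) (≤-trans (*-monoʳ-≤ P (bit≤1 b)) (≤-reflexive (*-identityʳ P))))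
  where P = 2 ^ length pre

heightAt-mountainsFrom-split-≤ : ∀ pre b rest {r k} → let q = length pre in
  suc k ≡ 2 ^ suc q + r → r < 2 ^ suc q →
  heightAt (mountainsFrom 0 (pre ++ b ∷ rest)) k ≤
  mmbBound q r (value₁ (pre ++ b ∷ rest) %2^ suc q) (value₁ (pre ++ b ∷ rest) %2^ suc (suc q))
heightAt-mountainsFrom-split-≤ pre b rest {r} {k} 1+k≡ r<Q = begin
  heightAt (mountainsFrom 0 (pre ++ b ∷ rest)) k                     ≡⟨ cong (λ hs → heightAt hs k) (mountainsFrom-++ 0 pre (b ∷ rest)) ⟩
  heightAt (mountainsFrom 0 pre ++ mountainsFrom q (b ∷ rest)) k     ≡⟨ heightAt-++ʳ (mountainsFrom 0 pre) _ sz<k ⟩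
  heightAt (mountainsFrom q (b ∷ rest)) (k ∸ sz)                     ≤⟨ heightAt-mountainsFrom-∷-≤ q b rest (value-< pre) k∸sz+v≡P+r r<Q ⟩
  mmbBound q r y (y + Q * (V % 2))                                   ≡⟨ cong₂ (mmbBound q r) (%2^-+* (suc q) V y<Q) (%2^-suc-+* (suc q) V y<Q) ⟨
  mmbBound q r ((y + V * Q) %2^ suc q) ((y + V * Q) %2^ suc (suc q))
    ≡⟨ cong (λ m → mmbBound q r (m %2^ suc q) (m %2^ suc (suc q))) (value₁-++-∷ pre b rest) ⟨
  mmbBound q r (value₁ (pre ++ b ∷ rest) %2^ suc q) (value₁ (pre ++ b ∷ rest) %2^ suc (suc q)) ∎
  where
  open ≤-Reasoning
  q = length pre
  P = 2 ^ q
  Q = 2 ^ suc q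
  v = value pre
  V = value₁ rest
  y = v + P * bit b
  y<Q = value+2^length*bit-< pre b
  sz = size (mountainsFrom 0 pre)
  1+sz≡v+P : suc sz ≡ v + P
  1+sz≡v+P = size-mountainsFrom-0 pre
  sz<k : sz < k
  sz<k = ≤-pred (begin-strict
    suc sz    ≡⟨ 1+sz≡v+P ⟩
    v + P     <⟨ +-monoˡ-< P (value-< pre) ⟩
    P + P     ≡⟨ cong (P +_) (+-identityʳ P) ⟨
    Q         ≤⟨ m≤m+n Q r ⟩
    Q + r     ≡⟨ 1+k≡ ⟨
    suc k     ∎)
  k∸sz+v≡P+r : k ∸ sz + v ≡ P + r
  k∸sz+v≡P+r = +-cancelʳ-≡ P _ _ (begin-equality
    k ∸ sz + v + P      ≡⟨ +-assoc (k ∸ sz) v P ⟩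
    k ∸ sz + (v + P)    ≡⟨ cong (k ∸ sz +_) 1+sz≡v+P ⟨
    k ∸ sz + suc sz     ≡⟨ +-suc (k ∸ sz) sz ⟩
    suc (k ∸ sz + sz)   ≡⟨ cong suc (m∸n+n≡m (<⇒≤ sz<k)) ⟩
    suc k               ≡⟨ 1+k≡ ⟩
    P + (P + 0) + r     ≡⟨ [m+n]+o≡[m+o]+n P (P + 0) r ⟩
    P + r + (P + 0)     ≡⟨ cong (P + r +_) (+-identityʳ P) ⟩
    P + r + P           ∎)

heightAt-mountainsFrom-≤ : ∀ {q r k} bs → suc k ≡ 2 ^ suc q + r → r < 2 ^ suc q → suc k ≤ value₁ bs →
  heightAt (mountainsFrom 0 bs) k ≤ mmbBound q r (value₁ bs %2^ suc q) (value₁ bs %2^ suc (suc q))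
heightAt-mountainsFrom-≤ {q} {r} bs 1+k≡ r<Q 1+k≤V
  with split-at q bs (2^[1+q]≤value₁⇒q<length bs (≤-trans (subst (2 ^ suc q ≤_) (sym 1+k≡) (m≤m+n _ r)) 1+k≤V))
... | pre , b , rest , refl , refl = heightAt-mountainsFrom-split-≤ pre b rest 1+k≡ r<Q

σMMB-≤ : ∀ {q r k n} → suc k ≡ 2 ^ suc q + r → r < 2 ^ suc q → k ≤ n →
         σMMB k n ≤ mmbBound q r (suc n %2^ suc q) (suc n %2^ suc (suc q))
σMMB-≤ {q} {r} {k} {n} 1+k≡ r<Q k≤n = begin
  σMMB k n                                   ≡⟨ σMMB≡heightAt-mountainsFrom 1≤k k≤n ⟩
  heightAt (mountainsFrom 0 (counter n)) k
    ≤⟨ heightAt-mountainsFrom-≤ {q} (counter n) 1+k≡ r<Q (subst (suc k ≤_) (sym (value₁-counter n)) (s≤s k≤n)) ⟩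
  mmbBound q r (V %2^ suc q) (V %2^ suc (suc q))   ≡⟨ cong (λ m → mmbBound q r (m %2^ suc q) (m %2^ suc (suc q))) (value₁-counter n) ⟩
  mmbBound q r (suc n %2^ suc q) (suc n %2^ suc (suc q)) ∎
  where
  open ≤-Reasoning
  V = value₁ (counter n)
  1≤k : 1 ≤ k
  1≤k = ≤-pred (subst (2 ≤_) (sym 1+k≡) (≤-trans (^-monoʳ-≤ 2 (s≤s (z≤n {q}))) (m≤m+n _ r)))

-- The U-MMR

half-≤ : ∀ {m f} → m ≤ suc f → m ℕ./ 2 ≤ f
half-≤ {zero}  _         = z≤n
half-≤ {suc m} (s≤s m≤f) = ≤-trans (≤-pred (m/n<m (suc m) 2 (s≤s (s≤s z≤n)))) m≤f

size-bitsFrom : ∀ f i m → m ≤ f → size (bitsFrom f i m) ≡ 2 ^ i * m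
size-bitsFrom zero    i .zero z≤n = sym (*-zeroʳ (2 ^ i))
size-bitsFrom (suc f) i m m≤1+f with m % 2 ≟ 1
... | yes m%2≡1 = begin
  2 ^ i + size (bitsFrom f (suc i) (m ℕ./ 2))  ≡⟨ cong₂ _+_ (sym (*-identityʳ (2 ^ i))) (size-bitsFrom f (suc i) (m ℕ./ 2) (half-≤ m≤1+f)) ⟩
  2 ^ i * 1 + 2 ^ suc i * (m ℕ./ 2)            ≡⟨ cong (λ b → 2 ^ i * b + 2 ^ suc i * (m ℕ./ 2)) m%2≡1 ⟨
  2 ^ i * (m % 2) + 2 ^ suc i * (m ℕ./ 2)      ≡⟨ *-halve (2 ^ i) m ⟨
  2 ^ i * m                                  ∎
  where open ≡-Reasoning
... | no m%2≢1 = begin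
  size (bitsFrom f (suc i) (m ℕ./ 2))          ≡⟨ size-bitsFrom f (suc i) (m ℕ./ 2) (half-≤ m≤1+f) ⟩
  2 ^ suc i * (m ℕ./ 2)                        ≡⟨ cong (λ b → b + 2 ^ suc i * (m ℕ./ 2)) (*-zeroʳ (2 ^ i)) ⟨
  2 ^ i * 0 + 2 ^ suc i * (m ℕ./ 2)            ≡⟨ cong (λ b → 2 ^ i * b + 2 ^ suc i * (m ℕ./ 2)) (%2≢1⇒%2≡0 m m%2≢1) ⟨
  2 ^ i * (m % 2) + 2 ^ suc i * (m ℕ./ 2)      ≡⟨ *-halve (2 ^ i) m ⟨
  2 ^ i * m                                  ∎
  where open ≡-Reasoning

σMMR≡heightAt-bitsFrom : ∀ {k n} → 1 ≤ k → k ≤ n → σMMR k n ≡ heightAt (bitsFrom n 0 n) k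
σMMR≡heightAt-bitsFrom {k} {n} 1≤k k≤n =
  trans (cong (λ m → heightAt (reverse (bitsFrom n 0 n)) (suc (m ∸ k))) (sym size≡n))
        (heightAt-reverse (bitsFrom n 0 n) 1≤k (subst (k ≤_) (sym size≡n) k≤n))
  where
  size≡n : size (bitsFrom n 0 n) ≡ n
  size≡n = trans (size-bitsFrom n 0 n ≤-refl) (*-identityˡ n)

-- The first 2 ^ i * (m %2^ suc j) leaves of bitsFrom f i m are exactly those in mountains
-- of height at most i + j, so each level j counted here lies below the mountain of leaf k.
levelsBelow : (i m k T : ℕ) → ℕ
levelsBelow i m k T = sumFrom (λ j → χ 0 k (2 ^ i * (m %2^ suc j))) 0 T

levelsBelow-suc : ∀ {i m k} c T → c ≡ 2 ^ i * (m % 2) → c < k →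
                  levelsBelow i m k (suc T) ≡ suc (levelsBelow (suc i) (m ℕ./ 2) (k ∸ c) T)
levelsBelow-suc {i} {m} {k} c T c≡ c<k = cong₂ _+_ (trans (cong (χ 0 k) (sym c≡)) (χ-inside z≤n c<k))
  (trans (sym (sumFrom-suc _ 0 T)) (sumFrom-cong 0 T λ j _ _ → shift j))
  where
  shift : ∀ j → χ 0 k (2 ^ i * (m %2^ suc (suc j))) ≡ χ 0 (k ∸ c) (2 ^ suc i * ((m ℕ./ 2) %2^ suc j))
  shift j = begin
    χ 0 k (2 ^ i * (m %2^ suc (suc j)))                       ≡⟨ cong (λ x → χ 0 k (2 ^ i * x)) (%2^-suc m (suc j)) ⟩
    χ 0 k (2 ^ i * (m % 2 + 2 * ((m ℕ./ 2) %2^ suc j)))         ≡⟨ cong (χ 0 k) (m*[n+2o]≡m*n+2m*o (2 ^ i) (m % 2) _) ⟩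
    χ 0 k (2 ^ i * (m % 2) + 2 ^ suc i * ((m ℕ./ 2) %2^ suc j)) ≡⟨ cong (λ x → χ 0 k (x + _)) c≡ ⟨
    χ 0 k (c + 2 ^ suc i * ((m ℕ./ 2) %2^ suc j))               ≡⟨ χ-shift _ (<⇒≤ c<k) ⟩
    χ 0 (k ∸ c) (2 ^ suc i * ((m ℕ./ 2) %2^ suc j))             ∎
    where open ≡-Reasoning

levelsBelow-descend : ∀ {i m k H} c → c ≡ 2 ^ i * (m % 2) → c < k →
                      (∀ T → suc i + levelsBelow (suc i) (m ℕ./ 2) (k ∸ c) T ≤ H) →
                      ∀ T → i + levelsBelow i m k T ≤ H
levelsBelow-descend {i} c c≡ c<k below-H zero    = ≤-trans (+-monoˡ-≤ 0 (n≤1+n i)) (below-H 0)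
levelsBelow-descend {i} {m} {k} {H} c c≡ c<k below-H (suc T) = begin
  i + levelsBelow i m k (suc T)                    ≡⟨ cong (i +_) (levelsBelow-suc {i} {m} {k} c T c≡ c<k) ⟩
  i + suc (levelsBelow (suc i) (m ℕ./ 2) (k ∸ c) T)  ≡⟨ +-suc i _ ⟩
  suc i + levelsBelow (suc i) (m ℕ./ 2) (k ∸ c) T    ≤⟨ below-H T ⟩
  H                                                ∎
  where open ≤-Reasoning

descend-≤ : ∀ {i m k} c → c ≡ 2 ^ i * (m % 2) → k ≤ 2 ^ i * m → k ∸ c ≤ 2 ^ suc i * (m ℕ./ 2)
descend-≤ {i} {m} {k} c c≡ k≤ = subst (k ∸ c ≤_) (m+n∸m≡n c _)
  (∸-monoˡ-≤ c (subst (k ≤_) (trans (*-halve (2 ^ i) m) (cong (_+ 2 ^ suc i * (m ℕ./ 2)) (sym c≡))) k≤))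

bitsFrom-heightAt-≥ : ∀ f i m {k} T → m ≤ f → 1 ≤ k → k ≤ 2 ^ i * m →
                      i + levelsBelow i m k T ≤ heightAt (bitsFrom f i m) k
bitsFrom-heightAt-≥ zero    i .zero {k} T z≤n 1≤k k≤ = contradiction (subst (k ≤_) (*-zeroʳ (2 ^ i)) k≤) (<⇒≱ 1≤k)
bitsFrom-heightAt-≥ (suc f) i m {k} T m≤1+f 1≤k k≤ with m % 2 ≟ 1
... | yes m%2≡1 = by-cases (k ≤? 2 ^ i)
  where
  2^i≡ : 2 ^ i ≡ 2 ^ i * (m % 2)
  2^i≡ = trans (sym (*-identityʳ (2 ^ i))) (cong (2 ^ i *_) (sym m%2≡1))
  2^i≤ : ∀ j → 2 ^ i ≤ 2 ^ i * (m %2^ suc j)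
  2^i≤ j = m≤m*n (2 ^ i) (m %2^ suc j) {{subst NonZero (sym (trans (%2^-suc m j) (cong (_+ 2 * ((m ℕ./ 2) %2^ j)) m%2≡1))) _}}
  by-cases : Dec (k ≤ 2 ^ i) → i + levelsBelow i m k T ≤ heightAt (i ∷ bitsFrom f (suc i) (m ℕ./ 2)) k
  by-cases (yes k≤2^i) = ≤-reflexive (begin
    i + levelsBelow i m k T  ≡⟨ cong (i +_) (sumFrom-const-on 0 0 T λ j _ _ → χ-above (≤-trans k≤2^i (2^i≤ j))) ⟩
    i + T * 0                ≡⟨ trans (cong (i +_) (*-zeroʳ T)) (+-identityʳ i) ⟩
    i                        ≡⟨ heightAt-head _ k≤2^i ⟨
    heightAt (i ∷ bitsFrom f (suc i) (m ℕ./ 2)) k ∎)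
    where open ≡-Reasoning
  by-cases (no k≰2^i) = subst (i + levelsBelow i m k T ≤_) (sym (heightAt-tail _ 2^i<k))
    (levelsBelow-descend {i} {m} {k} (2 ^ i) 2^i≡ 2^i<k
      (λ T → bitsFrom-heightAt-≥ f (suc i) (m ℕ./ 2) T (half-≤ m≤1+f) (m<n⇒0<n∸m 2^i<k)
                                   (descend-≤ {i} {m} {k} (2 ^ i) 2^i≡ k≤)) T)
    where
    2^i<k : 2 ^ i < k
    2^i<k = ≰⇒> k≰2^i
... | no m%2≢1 = levelsBelow-descend {i} {m} {k} 0 0≡ 1≤k
      (λ T → bitsFrom-heightAt-≥ f (suc i) (m ℕ./ 2) T (half-≤ m≤1+f) 1≤k (descend-≤ {i} {m} {k} 0 0≡ k≤)) T
  where
  0≡ : 0 ≡ 2 ^ i * (m % 2)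
  0≡ = trans (sym (*-zeroʳ (2 ^ i))) (cong (2 ^ i *_) (sym (%2≢1⇒%2≡0 m m%2≢1)))

-- 1 iff the k-th leaf from the right of the U-MMR with n leaves lies above height e.
aboveLevel : (k e n : ℕ) → ℕ
aboveLevel k e n = χ 0 k (n %2^ suc e)

σMMR-≥ : ∀ {k n d} T → 1 ≤ k → k ≤ n → 2 ^ d ≤ k → d + sumFrom (λ e → aboveLevel k e n) d T ≤ σMMR k n
σMMR-≥ {k} {n} {d} T 1≤k k≤n 2^d≤k = begin
  d + sumFrom (λ e → aboveLevel k e n) d T
    ≡⟨ cong₂ _+_ lowLevels (sumFrom-cong d T λ e _ _ → cong (χ 0 k) (*-identityˡ (n %2^ suc e))) ⟨
  levelsBelow 0 n k d + sumFrom (λ j → χ 0 k (1 * (n %2^ suc j))) d T ≡⟨ sumFrom-++ _ 0 d T ⟨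
  0 + levelsBelow 0 n k (d + T)
    ≤⟨ bitsFrom-heightAt-≥ n 0 n (d + T) ≤-refl 1≤k (subst (k ≤_) (sym (*-identityˡ n)) k≤n) ⟩
  heightAt (bitsFrom n 0 n) k                                ≡⟨ σMMR≡heightAt-bitsFrom 1≤k k≤n ⟨
  σMMR k n                                                   ∎
  where
  open ≤-Reasoning
  lowLevels : levelsBelow 0 n k d ≡ d
  lowLevels = trans (sumFrom-const-on 1 0 d λ j _ j<d → χ-inside z≤n (begin-strict
      1 * (n %2^ suc j)  ≡⟨ *-identityˡ _ ⟩
      n %2^ suc j        <⟨ %2^-< n (suc j) ⟩
      2 ^ suc j          ≤⟨ ^-monoʳ-≤ 2 j<d ⟩
      2 ^ d              ≤⟨ 2^d≤k ⟩
      k                  ∎))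
    (*-identityʳ d)

-- Averages over windows

sumFrom-σMMR-≥ : ∀ {k d} N T → 1 ≤ k → 2 ^ d ≤ k →
                 N * d + sumFrom (λ e → sumFrom (aboveLevel k e) k N) d T ≤ sumFrom (σMMR k) k N
sumFrom-σMMR-≥ {k} {d} N T 1≤k 2^d≤k = begin
  N * d + sumFrom (λ e → sumFrom (aboveLevel k e) k N) d T
    ≡⟨ cong₂ _+_ (sumFrom-const d k N) (sumFrom-comm (aboveLevel k) k N d T) ⟨
  sumFrom (λ _ → d) k N + sumFrom (λ n → sumFrom (λ e → aboveLevel k e n) d T) k N
    ≡⟨ sumFrom-+ (λ _ → d) _ k N ⟨
  sumFrom (λ n → d + sumFrom (λ e → aboveLevel k e n) d T) k N
    ≤⟨ sumFrom-mono k N (λ n k≤n _ → σMMR-≥ T 1≤k k≤n 2^d≤k) ⟩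
  sumFrom (σMMR k) k N ∎
  where open ≤-Reasoning

sumFrom-aboveLevel-≥ : ∀ {k e} a N → k ≤ 2 ^ suc e → N * k ≤ 2 ^ suc e * (k + sumFrom (aboveLevel k e) a N)
sumFrom-aboveLevel-≥ {k} {e} a N k≤ = sumFrom-χ-%-≥ {{m^n≢0 2 (suc e)}} z≤n k≤ a N

-- That is, Σ C ≥ N k (2 ^ -d - 2 ^ -(d + T)) - T k.
levels-≥ : ∀ {k N} (C : ℕ → ℕ) d T → (∀ e → d ≤ e → N * k ≤ 2 ^ suc e * (k + C e)) →
           2 ^ T * (N * k) ≤ 2 ^ d * 2 ^ T * (T * k + sumFrom C d T) + N * k
levels-≥ {k} {N} C d zero    _       = subst (_≤ 2 ^ d * 1 * 0 + N * k) (sym (*-identityˡ (N * k))) (m≤n+m (N * k) _)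
levels-≥ {k} {N} C d (suc T) level-e = begin
  2 ^ suc T * (N * k)                                                       ≡⟨ double (2 ^ T) (N * k) ⟩
  2 ^ T * (N * k) + 2 ^ T * (N * k)                                         ≤⟨ +-mono-≤ (levels-≥ {k} {N} C (suc d) T λ e d<e → level-e e (<⇒≤ d<e))
                                                                                         (*-monoʳ-≤ (2 ^ T) (level-e d ≤-refl)) ⟩
  (2 ^ suc d * 2 ^ T * (T * k + W) + N * k) + 2 ^ T * (2 ^ suc d * (k + C d)) ≡⟨ regroup (2 ^ d) (2 ^ T) T k (C d) W (N * k) ⟩
  2 ^ d * 2 ^ suc T * (suc T * k + (C d + W)) + N * k                       ∎
  where
  open ≤-Reasoning
  W = sumFrom C (suc d) T
  double : ∀ G x → 2 * G * x ≡ G * x + G * x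
  double = solve-∀
  regroup : ∀ K G T k c W x → (2 * K * G * (T * k + W) + x) + G * (2 * K * (k + c)) ≡ K * (2 * G) * ((1 + T) * k + (c + W)) + x
  regroup = solve-∀

-- By sumFrom-σMMB-≤, the average of σMMB k over long windows is at most
-- q + excess (2 ^ q) r / 2 ^ (q + 2), the three indicators of mmbBound having densities
-- r / 2 ^ (q + 1), (2 ^ (q + 1) - r ⊔ 2 ^ q) / 2 ^ (q + 1) and r / 2 ^ (q + 2).
excess : ℕ → ℕ → ℕ
excess P r = 3 * r + 2 * (2 * P ∸ (r ⊔ P))

sumFrom-σMMB-≤ : ∀ {q r k} N → suc k ≡ 2 ^ suc q + r → r < 2 ^ suc q →
                 2 * 2 ^ suc q * sumFrom (σMMB k) k N ≤ 2 * 2 ^ suc q * q * N + (2 * 2 ^ suc q + N) * excess (2 ^ q) r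
sumFrom-σMMB-≤ {q} {r} {k} N 1+k≡ r<Q = begin
  2 * Q * sumFrom (σMMB k) k N                          ≤⟨ *-monoʳ-≤ (2 * Q) (sumFrom-mono k N λ n k≤n _ → σMMB-≤ {q} 1+k≡ r<Q k≤n) ⟩
  2 * Q * sumFrom (λ n → q + f₁ (suc n) + f₂ (suc n) + f₃ (suc n)) k N ≡⟨ cong (2 * Q *_) (sumFrom-+-suc₃ q f₁ f₂ f₃ k N) ⟩
  2 * Q * (N * q + U₁ + U₂ + U₃)                        ≡⟨ distribute Q q N U₁ U₂ U₃ ⟩
  2 * Q * q * N + 2 * (Q * U₁) + 2 * (Q * U₂) + 2 * Q * U₃
    ≤⟨ +-mono-≤ (+-mono-≤ (+-monoʳ-≤ (2 * Q * q * N) (*-monoʳ-≤ 2 U₁-≤)) (*-monoʳ-≤ 2 U₂-≤)) U₃-≤ ⟩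
  2 * Q * q * N + 2 * ((2 * Q + N) * r) + 2 * ((2 * Q + N) * g) + (2 * Q + N) * r ≡⟨ collect (2 * Q * q * N) (2 * Q + N) r g ⟩
  2 * Q * q * N + (2 * Q + N) * excess P r              ∎
  where
  open ≤-Reasoning
  P = 2 ^ q
  Q = 2 ^ suc q
  g = Q ∸ (r ⊔ P)
  f₁ f₂ f₃ : ℕ → ℕ
  f₁ m = χ 0 r (m %2^ suc q)
  f₂ m = χ (r ⊔ P) Q (m %2^ suc q)
  f₃ m = χ Q (Q + r) (m %2^ suc (suc q))
  U₁ = sumFrom f₁ (suc k) N
  U₂ = sumFrom f₂ (suc k) N
  U₃ = sumFrom f₃ (suc k) N
  distribute : ∀ Q q N u₁ u₂ u₃ → 2 * Q * (N * q + u₁ + u₂ + u₃) ≡ 2 * Q * q * N + 2 * (Q * u₁) + 2 * (Q * u₂) + 2 * Q * u₃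
  distribute = solve-∀
  collect : ∀ a b r g → a + 2 * (b * r) + 2 * (b * g) + b * r ≡ a + b * (3 * r + 2 * g)
  collect = solve-∀
  Q≤2Q+N : Q + N ≤ 2 * Q + N
  Q≤2Q+N = +-monoˡ-≤ N (m≤m+n Q _)
  U₁-≤ : Q * U₁ ≤ (2 * Q + N) * r
  U₁-≤ = ≤-trans (sumFrom-χ-%-≤ {{m^n≢0 2 (suc q)}} z≤n (<⇒≤ r<Q) (suc k) N) (*-monoˡ-≤ r Q≤2Q+N)
  U₂-≤ : Q * U₂ ≤ (2 * Q + N) * g
  U₂-≤ = ≤-trans (sumFrom-χ-%-≤ {{m^n≢0 2 (suc q)}} (⊔-lub (<⇒≤ r<Q) (m≤m+n P _)) ≤-refl (suc k) N) (*-monoˡ-≤ g Q≤2Q+N)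
  U₃-≤ : 2 * Q * U₃ ≤ (2 * Q + N) * r
  U₃-≤ = subst (2 * Q * U₃ ≤_) (cong ((2 * Q + N) *_) (m+n∸m≡n Q r))
    (sumFrom-χ-%-≤ {{m^n≢0 2 (suc (suc q))}} (m≤m+n Q r)
      (subst (Q + r ≤_) (cong (Q +_) (sym (+-identityʳ Q))) (+-monoʳ-≤ Q (<⇒≤ r<Q))) (suc k) N)

-- The constant 5/4 - 3/(2(k + 1))

-- d + k / K - (q + F / 4P) ≥ 5/4 - 3/(2(k + 1)), where P = 2 ^ q, K = 2 ^ d and d = q + δ,
-- multiplied by 16 (k + 1) P K.
record Gap (k P K δ F : ℕ) : Set where
  constructor mkGap
  field
    inequality : let t = 2 * (1 + k) in
      2 * t * F * K + 5 * t * (2 * P) * K ≤ 4 * t * (2 * P) * K * δ + 4 * t * (2 * P) * k + 12 * (2 * P) * K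

Gap-subst : ∀ {k k′ P P′ K K′ δ F F′} → k ≡ k′ → P ≡ P′ → K ≡ K′ → F ≡ F′ →
            Gap k′ P′ K′ δ F′ → Gap k P K δ F
Gap-subst refl refl refl refl gap = gap

≤-by-slack : ∀ {a b} c → a + c ≡ b → a ≤ b
≤-by-slack {a} c a+c≡b = subst (a ≤_) a+c≡b (m≤m+n a c)

gap-polynomial₀ : ∀ h → Gap (1 + 2 * h) (1 + h) (1 + h) 0 (2 * (1 + h))
gap-polynomial₀ h = mkGap (≤-by-slack (8 * ((1 + h) * (1 + h)) * h) (solve (h ∷ [])))

gap-polynomial₁ : ∀ r′ d → Gap (2 * (1 + r′ + d) + r′) (1 + r′ + d) (2 * (1 + r′ + d)) 1 (3 * (1 + r′) + 2 * (1 + r′ + d))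
gap-polynomial₁ r′ d = mkGap (≤-by-slack (8 * (1 + r′ + d) * d * (3 * (1 + r′) + 2 * d + 2)) (solve (r′ ∷ d ∷ [])))

gap-polynomial₂ : ∀ s′ g → Gap (3 + 4 * s′ + 3 * g) (1 + s′ + g) (2 * (1 + s′ + g)) 1 (3 * (2 * (1 + s′) + g) + 2 * g)
gap-polynomial₂ s′ g = mkGap (≤-by-slack (8 * (1 + s′ + g) * (1 + s′) * (2 + 4 * s′ + 3 * g)) (solve (s′ ∷ g ∷ [])))

2*n∸n≡n : ∀ n → 2 * n ∸ n ≡ n
2*n∸n≡n n = trans (m+n∸m≡n n (n + 0)) (+-identityʳ n)

gap-r≡0 : ∀ {k P} → 1 ≤ P → suc k ≡ 2 * P + 0 → Gap k P P 0 (excess P 0)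
gap-r≡0 {k} 1≤P 1+k≡ with m≤n⇒∃[o]m+o≡n 1≤P
... | h , refl = Gap-subst k≡ refl refl (cong (2 *_) (2*n∸n≡n (1 + h))) (gap-polynomial₀ h)
  where
  k≡ : k ≡ 1 + 2 * h
  k≡ = suc-injective (trans 1+k≡ (trans (+-identityʳ _) (*-suc 2 h)))

gap-r≤P : ∀ {k P r} → 1 ≤ r → r ≤ P → suc k ≡ 2 * P + r → Gap k P (2 * P) 1 (excess P r)
gap-r≤P {k} {r = suc r′} _ r≤P 1+k≡ with m≤n⇒∃[o]m+o≡n r≤P
... | d , refl = Gap-subst (suc-injective (trans 1+k≡ (+-suc _ r′))) refl refl F≡ (gap-polynomial₁ r′ d)
  where
  P = 1 + r′ + d
  F≡ : excess P (1 + r′) ≡ 3 * (1 + r′) + 2 * P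
  F≡ = cong (λ x → 3 * (1 + r′) + 2 * x) (trans (cong (2 * P ∸_) (m≤n⇒m⊔n≡n r≤P)) (2*n∸n≡n P))

gap-P<r : ∀ {k P r} → P < r → r < 2 * P → suc k ≡ 2 * P + r → Gap k P (2 * P) 1 (excess P r)
gap-P<r {k} {P} {r} P<r r<2P 1+k≡ with m≤n⇒∃[o]m+o≡n P<r | m≤n⇒∃[o]m+o≡n (<⇒≤ r<2P)
... | s′ , 1+P+s′≡r | g , r+g≡2P = Gap-subst k≡ P≡ (cong (2 *_) P≡) F≡ (gap-polynomial₂ s′ g)
  where
  open ≡-Reasoning
  P≡ : P ≡ 1 + s′ + g
  P≡ = +-cancelˡ-≡ P P (1 + s′ + g) (begin
    P + P            ≡⟨ cong (P +_) (+-identityʳ P) ⟨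
    2 * P            ≡⟨ r+g≡2P ⟨
    r + g            ≡⟨ cong (_+ g) 1+P+s′≡r ⟨
    1 + P + s′ + g   ≡⟨ solve (P ∷ s′ ∷ g ∷ []) ⟩
    P + (1 + s′ + g) ∎)
  r≡ : r ≡ 2 * (1 + s′) + g
  r≡ = begin
    r                     ≡⟨ 1+P+s′≡r ⟨
    1 + P + s′            ≡⟨ cong (λ x → 1 + x + s′) P≡ ⟩
    1 + (1 + s′ + g) + s′ ≡⟨ solve (s′ ∷ g ∷ []) ⟩
    2 * (1 + s′) + g      ∎
  k≡ : k ≡ 3 + 4 * s′ + 3 * g
  k≡ = suc-injective (begin
    suc k                                 ≡⟨ 1+k≡ ⟩
    2 * P + r                             ≡⟨ cong₂ (λ x y → 2 * x + y) P≡ r≡ ⟩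
    2 * (1 + s′ + g) + (2 * (1 + s′) + g) ≡⟨ solve (s′ ∷ g ∷ []) ⟩
    4 + 4 * s′ + 3 * g                    ∎)
  F≡ : excess P r ≡ 3 * (2 * (1 + s′) + g) + 2 * g
  F≡ = begin
    3 * r + 2 * (2 * P ∸ (r ⊔ P))  ≡⟨ cong (λ x → 3 * r + 2 * (2 * P ∸ x)) (m≥n⇒m⊔n≡m (<⇒≤ P<r)) ⟩
    3 * r + 2 * (2 * P ∸ r)        ≡⟨ cong (λ x → 3 * r + 2 * (x ∸ r)) r+g≡2P ⟨
    3 * r + 2 * (r + g ∸ r)        ≡⟨ cong (λ x → 3 * r + 2 * x) (m+n∸m≡n r g) ⟩
    3 * r + 2 * g                  ≡⟨ cong (λ x → 3 * x + 2 * g) r≡ ⟩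
    3 * (2 * (1 + s′) + g) + 2 * g ∎

decompose : ∀ m → 2 ≤ m → ∃[ q ] ∃[ r ] (m ≡ 2 ^ suc q + r × r < 2 ^ suc q)
decompose (suc (suc zero))    _ = 0 , 0 , refl , s≤s z≤n
decompose (suc zero)          (s≤s ())
decompose (suc (suc (suc m))) _ with decompose (suc (suc m)) (s≤s (s≤s z≤n))
... | q , r , 2+m≡ , r<Q with suc r <? 2 ^ suc q
...   | yes 1+r<Q = q , suc r , trans (cong suc 2+m≡) (sym (+-suc _ r)) , 1+r<Q
...   | no 1+r≮Q  = suc q , 0 , 3+m≡ , m^n>0 2 (suc (suc q))
  where
  Q = 2 ^ suc q
  3+m≡ : suc (suc (suc m)) ≡ 2 ^ suc (suc q) + 0
  3+m≡ = begin
    suc (suc (suc m))  ≡⟨ cong suc 2+m≡ ⟩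
    suc (Q + r)        ≡⟨ +-suc Q r ⟨
    Q + suc r          ≡⟨ cong (Q +_) (≤-antisym r<Q (≮⇒≥ 1+r≮Q)) ⟩
    Q + Q              ≡⟨ cong (Q +_) (+-identityʳ Q) ⟨
    2 * Q              ≡⟨ +-identityʳ (2 * Q) ⟨
    2 * Q + 0          ∎
    where open ≡-Reasoning

gap-exists : ∀ {k q r} → suc k ≡ 2 ^ suc q + r → r < 2 ^ suc q →
             ∃[ δ ] (2 ^ (q + δ) ≤ k × k ≤ 2 ^ suc (q + δ) × Gap k (2 ^ q) (2 ^ (q + δ)) δ (excess (2 ^ q) r))
gap-exists {k} {q} {zero} 1+k≡ _ =
  0 , subst (_≤ k) P≡ P≤k , subst (k ≤_) (cong (2 *_) P≡) k≤2P , subst (λ K → Gap k P K 0 (excess P 0)) P≡ (gap-r≡0 1≤P 1+k≡)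
  where
  P = 2 ^ q
  P≡ : P ≡ 2 ^ (q + 0)
  P≡ = cong (2 ^_) (sym (+-identityʳ q))
  1≤P : 1 ≤ P
  1≤P = m^n>0 2 q
  2P≡1+k : 2 * P ≡ suc k
  2P≡1+k = trans (sym (+-identityʳ (2 * P))) (sym 1+k≡)
  P≤k : P ≤ k
  P≤k = ≤-pred (subst (suc P ≤_) 2P≡1+k (subst (_≤ 2 * P) (+-comm P 1) (+-monoʳ-≤ P (subst (1 ≤_) (sym (+-identityʳ P)) 1≤P))))
  k≤2P : k ≤ 2 * P
  k≤2P = subst (k ≤_) (sym 2P≡1+k) (n≤1+n k)
gap-exists {k} {q} {suc r′} 1+k≡ r<Q =
  1 , subst (_≤ k) K≡ 2P≤k , subst (k ≤_) (cong (2 *_) K≡) k≤4P , subst (λ K → Gap k P K 1 (excess P r)) K≡ (by-cases (r ≤? P))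
  where
  P = 2 ^ q
  r = suc r′
  K≡ : 2 * P ≡ 2 ^ (q + 1)
  K≡ = cong (2 ^_) (+-comm 1 q)
  k≡ : k ≡ 2 * P + r′
  k≡ = suc-injective (trans 1+k≡ (+-suc (2 * P) r′))
  2P≤k : 2 * P ≤ k
  2P≤k = subst (2 * P ≤_) (sym k≡) (m≤m+n (2 * P) r′)
  k≤4P : k ≤ 2 * (2 * P)
  k≤4P = subst (_≤ 2 * (2 * P)) (sym k≡) (subst (2 * P + r′ ≤_) (cong (2 * P +_) (sym (+-identityʳ (2 * P))))
    (+-monoʳ-≤ (2 * P) (≤-trans (n≤1+n r′) (<⇒≤ r<Q))))
  by-cases : Dec (r ≤ P) → Gap k P (2 * P) 1 (excess P r)
  by-cases (yes r≤P) = gap-r≤P (s≤s z≤n) r≤P 1+k≡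
  by-cases (no r≰P)  = gap-P<r (≰⇒> r≰P) r<Q 1+k≡

n<2^n : ∀ n → n < 2 ^ n
n<2^n zero    = s≤s z≤n
n<2^n (suc n) = begin-strict
  suc n          ≤⟨ n<2^n n ⟩
  2 ^ n          ≡⟨ +-identityʳ (2 ^ n) ⟨
  2 ^ n + 0      <⟨ +-monoʳ-< (2 ^ n) (m^n>0 2 n) ⟩
  2 ^ n + 2 ^ n  ≡⟨ cong (2 ^ n +_) (+-identityʳ (2 ^ n)) ⟨
  2 ^ suc n      ∎
  where open ≤-Reasoning

-- That is, SR ≥ N d + N k / K - T k - N / 2e.
σMMR-estimate : ∀ {e k N K G T W d SR} .{{_ : NonZero K}} .{{_ : NonZero G}} →
  N * d + W ≤ SR → G * (N * k) ≤ K * G * (T * k + W) + N * k → 2 * e * k ≤ G →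
  2 * e * K * (N * d) + 2 * e * (N * k) ≤ 2 * e * K * (T * k + SR) + K * N
σMMR-estimate {e} {k} {N} {K} {G} {T} {W} {d} {SR} Nd+W≤SR levels 2ek≤G = begin
  2 * e * K * (N * d) + 2 * e * (N * k)      ≤⟨ +-monoʳ-≤ (2 * e * K * (N * d)) (*-cancelˡ-≤ G weighted) ⟩
  2 * e * K * (N * d) + (2 * e * K * (T * k + W) + K * N) ≡⟨ solve (e ∷ K ∷ N ∷ d ∷ T ∷ k ∷ W ∷ []) ⟩
  2 * e * K * (T * k + (N * d + W)) + K * N  ≤⟨ +-monoˡ-≤ (K * N) (*-monoʳ-≤ (2 * e * K) (+-monoʳ-≤ (T * k) Nd+W≤SR)) ⟩
  2 * e * K * (T * k + SR) + K * N           ∎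
  where
  open ≤-Reasoning
  weighted : G * (2 * e * (N * k)) ≤ G * (2 * e * K * (T * k + W) + K * N)
  weighted = begin
    G * (2 * e * (N * k))                             ≡⟨ solve (G ∷ e ∷ N ∷ k ∷ []) ⟩
    2 * e * (G * (N * k))                             ≤⟨ *-monoʳ-≤ (2 * e) levels ⟩
    2 * e * (K * G * (T * k + W) + N * k)             ≡⟨ solve (e ∷ K ∷ G ∷ T ∷ k ∷ W ∷ N ∷ []) ⟩
    G * (2 * e * K * (T * k + W)) + (2 * e * k) * N   ≤⟨ +-monoʳ-≤ _ (*-monoˡ-≤ N 2ek≤G) ⟩
    G * (2 * e * K * (T * k + W)) + G * N             ≤⟨ +-monoʳ-≤ _ (*-monoʳ-≤ G (m≤n*m N K)) ⟩
    G * (2 * e * K * (T * k + W)) + G * (K * N)       ≡⟨ *-distribˡ-+ G _ (K * N) ⟨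
    G * (2 * e * K * (T * k + W) + K * N)             ∎

-- Multiplied by 2QK, where Q = 2P, the conclusion is a nonnegative combination of the hypotheses.
gap-estimate : ∀ {SR SB N K P q δ k e T F t} .{{_ : NonZero P}} .{{_ : NonZero K}} →
  2 * e * K * (N * (q + δ)) + 2 * e * (N * k) ≤ 2 * e * K * (T * k + SR) + K * N →
  2 * (2 * P) * SB ≤ 2 * (2 * P) * q * N + (2 * (2 * P) + N) * F →
  2 * t * F * K + 5 * t * (2 * P) * K ≤ 4 * t * (2 * P) * K * δ + 4 * t * (2 * P) * k + 12 * (2 * P) * K →
  e * (2 * (2 * P) * (T * k + F)) ≤ N →
  4 * t * e * SB + 5 * t * e * N ≤ 4 * t * e * SR + 12 * e * N + 4 * t * N
gap-estimate {SR} {SB} {N} {K} {P} {q} {δ} {k} {e} {T} {F} {t} mmr mmb gap constants =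
  *-cancelˡ-≤ (2 * (2 * P) * K) {{2QK≢0}} (begin
  2 * (2 * P) * K * (4 * t * e * SB + 5 * t * e * N)
    ≡⟨ solve (SB ∷ N ∷ K ∷ P ∷ e ∷ t ∷ []) ⟩
  4 * t * e * K * (2 * (2 * P) * SB) + 10 * t * e * (2 * P) * K * N
    ≤⟨ +-monoˡ-≤ _ (*-monoʳ-≤ (4 * t * e * K) mmb) ⟩
  4 * t * e * K * (2 * (2 * P) * q * N + (2 * (2 * P) + N) * F) + 10 * t * e * (2 * P) * K * N
    ≡⟨ solve (N ∷ K ∷ P ∷ q ∷ e ∷ F ∷ t ∷ []) ⟩
  8 * t * e * (2 * P) * K * q * N + 2 * e * N * (2 * t * F * K + 5 * t * (2 * P) * K) + 8 * t * e * (2 * P) * K * F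
    ≤⟨ +-monoˡ-≤ (8 * t * e * (2 * P) * K * F) (+-monoʳ-≤ (8 * t * e * (2 * P) * K * q * N) (*-monoʳ-≤ (2 * e * N) gap)) ⟩
  8 * t * e * (2 * P) * K * q * N + 2 * e * N * (4 * t * (2 * P) * K * δ + 4 * t * (2 * P) * k + 12 * (2 * P) * K)
    + 8 * t * e * (2 * P) * K * F
    ≡⟨ solve (N ∷ K ∷ P ∷ q ∷ δ ∷ k ∷ e ∷ F ∷ t ∷ []) ⟩
  4 * t * (2 * P) * (2 * e * K * (N * (q + δ)) + 2 * e * (N * k)) + 24 * e * (2 * P) * K * N + 8 * t * e * (2 * P) * K * F
    ≤⟨ +-monoˡ-≤ (8 * t * e * (2 * P) * K * F) (+-monoˡ-≤ (24 * e * (2 * P) * K * N) (*-monoʳ-≤ (4 * t * (2 * P)) mmr)) ⟩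
  4 * t * (2 * P) * (2 * e * K * (T * k + SR) + K * N) + 24 * e * (2 * P) * K * N + 8 * t * e * (2 * P) * K * F
    ≡⟨ solve (SR ∷ N ∷ K ∷ P ∷ k ∷ e ∷ T ∷ F ∷ t ∷ []) ⟩
  2 * (2 * P) * K * (4 * t * e * SR + 12 * e * N) + 4 * t * K * (e * (2 * (2 * P) * (T * k + F))) + 4 * t * (2 * P) * K * N
    ≤⟨ +-monoˡ-≤ (4 * t * (2 * P) * K * N) (+-monoʳ-≤ (2 * (2 * P) * K * (4 * t * e * SR + 12 * e * N)) (*-monoʳ-≤ (4 * t * K) constants)) ⟩
  2 * (2 * P) * K * (4 * t * e * SR + 12 * e * N) + 4 * t * K * N + 4 * t * (2 * P) * K * N
    ≤⟨ +-monoˡ-≤ (4 * t * (2 * P) * K * N) (+-monoʳ-≤ (2 * (2 * P) * K * (4 * t * e * SR + 12 * e * N)) (m≤n*m (4 * t * K * N) (2 * P) {{m*n≢0 2 P}})) ⟩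
  2 * (2 * P) * K * (4 * t * e * SR + 12 * e * N) + 2 * P * (4 * t * K * N) + 4 * t * (2 * P) * K * N
    ≡⟨ solve (SR ∷ N ∷ K ∷ P ∷ e ∷ t ∷ []) ⟩
  2 * (2 * P) * K * (4 * t * e * SR + 12 * e * N + 4 * t * N) ∎)
  where
  open ≤-Reasoning
  2QK≢0 : NonZero (2 * (2 * P) * K)
  2QK≢0 = m*n≢0 (2 * (2 * P)) K {{m*n≢0 2 (2 * P) {{_}} {{m*n≢0 2 P}}}}

-- Imported only here: ℤ's prefix +_ would make the sections (x +_) above ambiguous.
open import Data.Integer.Base as ℤ using (ℤ; +_)
import Data.Integer.Properties as ℤₚ
import Data.Integer.Tactic.RingSolver as ℤSolver
open import Data.Rational.Base as ℚ using (ℚ; 0ℚ; _/_; _-_; toℚᵘ)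
import Data.Rational.Properties as ℚₚ
open import Data.Rational.Unnormalised.Base as ℚᵘ using (mkℚᵘ)
import Data.Rational.Unnormalised.Properties as ℚᵘₚ

cross-multiplied : ∀ (t E N SR SB : ℤ) →
  + 4 ℤ.* t ℤ.* E ℤ.* SB ℤ.+ + 5 ℤ.* t ℤ.* E ℤ.* N ℤ.≤
  + 4 ℤ.* t ℤ.* E ℤ.* SR ℤ.+ + 12 ℤ.* E ℤ.* N ℤ.+ + 4 ℤ.* t ℤ.* N →
  ((+ 5 ℤ.* t ℤ.+ ℤ.- + 3 ℤ.* + 4) ℤ.* E ℤ.+ ℤ.- + 1 ℤ.* (+ 4 ℤ.* t)) ℤ.* N ℤ.≤ (SR ℤ.- SB) ℤ.* (+ 4 ℤ.* t ℤ.* E)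
cross-multiplied t E N SR SB A≤B = ℤₚ.0≤i-j⇒j≤i (subst (ℤ.0ℤ ℤ.≤_) same-difference (ℤₚ.i≤j⇒0≤j-i A≤B))
  where
  same-difference :
    (+ 4 ℤ.* t ℤ.* E ℤ.* SR ℤ.+ + 12 ℤ.* E ℤ.* N ℤ.+ + 4 ℤ.* t ℤ.* N) ℤ.-
    (+ 4 ℤ.* t ℤ.* E ℤ.* SB ℤ.+ + 5 ℤ.* t ℤ.* E ℤ.* N) ≡
    (SR ℤ.- SB) ℤ.* (+ 4 ℤ.* t ℤ.* E) ℤ.- ((+ 5 ℤ.* t ℤ.+ ℤ.- + 3 ℤ.* + 4) ℤ.* E ℤ.+ ℤ.- + 1 ℤ.* (+ 4 ℤ.* t)) ℤ.* N
  same-difference = ℤSolver.solve (t ∷ E ∷ N ∷ SR ∷ SB ∷ [])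

toℚᵘ-/ : ∀ p n → toℚᵘ (p / suc n) ℚᵘ.≃ mkℚᵘ p n
toℚᵘ-/ p n = ℚₚ.toℚᵘ-fromℚᵘ (mkℚᵘ p n)

toℚᵘ-homo-− : ∀ x y → toℚᵘ (x - y) ℚᵘ.≃ toℚᵘ x ℚᵘ.- toℚᵘ y
toℚᵘ-homo-− x y = ℚᵘₚ.≃-trans (ℚₚ.toℚᵘ-homo-+ x (ℚ.- y)) (ℚᵘₚ.+-congʳ (toℚᵘ x) (ℚₚ.toℚᵘ-homo‿- y))

−-cong : ∀ {x x′ y y′} → x ℚᵘ.≃ x′ → y ℚᵘ.≃ y′ → x ℚᵘ.- y ℚᵘ.≃ x′ ℚᵘ.- y′
−-cong x≃x′ y≃y′ = ℚᵘₚ.+-cong x≃x′ (ℚᵘₚ.-‿cong y≃y′)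

ℚ-estimate : ∀ {k e N′ SR SB} → let t = 2 * suc k ; E = suc e ; N = suc N′ in
  4 * t * E * SB + 5 * t * E * N ≤ 4 * t * E * SR + 12 * E * N + 4 * t * N →
  ((+ 5 / 4) - (+ 3 / t)) - (+ 1 / E) ℚ.≤ (+ SR ℤ.- + SB) / N
ℚ-estimate {k} {e} {N′} {SR} {SB} A≤B = ℚₚ.toℚᵘ-cancel-≤ (begin
  toℚᵘ (((+ 5 / 4) - (+ 3 / t)) - (+ 1 / E))                 ≃⟨ toℚᵘ-homo-− ((+ 5 / 4) - (+ 3 / t)) (+ 1 / E) ⟩
  toℚᵘ ((+ 5 / 4) - (+ 3 / t)) ℚᵘ.- toℚᵘ (+ 1 / E)          ≃⟨ −-cong (toℚᵘ-homo-− (+ 5 / 4) (+ 3 / t)) (toℚᵘ-/ (+ 1) e) ⟩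
  (toℚᵘ (+ 5 / 4) ℚᵘ.- toℚᵘ (+ 3 / t)) ℚᵘ.- mkℚᵘ (+ 1) e   ≃⟨ −-cong (−-cong (toℚᵘ-/ (+ 5) 3) (toℚᵘ-/ (+ 3) (pred t))) ℚᵘₚ.≃-refl ⟩
  (mkℚᵘ (+ 5) 3 ℚᵘ.- mkℚᵘ (+ 3) (pred t)) ℚᵘ.- mkℚᵘ (+ 1) e ≤⟨ ℚᵘ.*≤* (cross-multiplied (+ t) (+ E) (+ N) (+ SR) (+ SB) A≤B′) ⟩
  mkℚᵘ (+ SR ℤ.- + SB) N′                                    ≃⟨ toℚᵘ-/ (+ SR ℤ.- + SB) N′ ⟨
  toℚᵘ ((+ SR ℤ.- + SB) / N)                                 ∎)
  where
  open ℚᵘₚ.≤-Reasoning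
  t = 2 * suc k
  E = suc e
  N = suc N′
  A≤B′ : + 4 ℤ.* + t ℤ.* + E ℤ.* + SB ℤ.+ + 5 ℤ.* + t ℤ.* + E ℤ.* + N ℤ.≤
         + 4 ℤ.* + t ℤ.* + E ℤ.* + SR ℤ.+ + 12 ℤ.* + E ℤ.* + N ℤ.+ + 4 ℤ.* + t ℤ.* + N
  A≤B′ = subst₂ ℤ._≤_ (cong (ℤ._+ + (5 * t * E * N)) (ℤₚ.pos-* (4 * t * E) SB))
                      (cong (λ x → x ℤ.+ + (12 * E * N) ℤ.+ + (4 * t * N)) (ℤₚ.pos-* (4 * t * E) SR))
                      (ℤ.+≤+ A≤B)

positive⇒1/suc≤ : ∀ ε → 0ℚ ℚ.< ε → ∃[ e ] (+ 1 / suc e ℚ.≤ ε)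
positive⇒1/suc≤ (ℚ.mkℚ (+ zero)    d _) (ℚ.*<* (ℤ.+<+ ()))
positive⇒1/suc≤ (ℚ.mkℚ ℤ.-[1+ _ ]  d _) (ℚ.*<* ())
positive⇒1/suc≤ (ℚ.mkℚ (+ suc a)   d _) _ = d , ℚₚ.toℚᵘ-cancel-≤
  (ℚᵘₚ.≤-respˡ-≃ (ℚᵘₚ.≃-sym (toℚᵘ-/ (+ 1) d)) (ℚᵘ.*≤* (ℤ.+≤+ (s≤s (+-monoʳ-≤ d z≤n)))))

avgDiff-≥ : ∀ {k} e → 1 ≤ k →
  ∃[ N₀ ] ((N : ℕ) → .{{_ : NonZero N}} → N₀ ≤ N → ((+ 5 / 4) - (+ 3 / (2 * suc k))) - (+ 1 / suc e) ℚ.≤ avgDiff k N)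
avgDiff-≥ {k} e 1≤k with decompose (suc k) (s≤s 1≤k)
... | q , r , 1+k≡ , r<Q with gap-exists {k} {q} {r} 1+k≡ r<Q
... | δ , 2^d≤k , k≤2^[1+d] , gap = E * (2 * (2 * P) * (T * k + excess P r)) , bound
  where
  E = suc e
  P = 2 ^ q
  d = q + δ
  T = 2 * E * k
  bound : (N : ℕ) → .{{_ : NonZero N}} → E * (2 * (2 * P) * (T * k + excess P r)) ≤ N →
          ((+ 5 / 4) - (+ 3 / (2 * suc k))) - (+ 1 / E) ℚ.≤ avgDiff k N
  bound N@(suc N′) N₀≤N = ℚ-estimate {k} {e} {N′} {SR} {SB}
    (gap-estimate {SR} {SB} {N} {2 ^ d} {P} {q} {δ} {k} {E} {T} {excess P r} {2 * (1 + k)} {{m^n≢0 2 q}} {{m^n≢0 2 d}}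
    σMMR-bound (sumFrom-σMMB-≤ {q} N 1+k≡ r<Q) (Gap.inequality gap) N₀≤N)
    where
    SR = sumFrom (σMMR k) k N
    SB = sumFrom (σMMB k) k N
    W = sumFrom (λ j → sumFrom (aboveLevel k j) k N) d T
    levels : 2 ^ T * (N * k) ≤ 2 ^ d * 2 ^ T * (T * k + W) + N * k
    levels = levels-≥ {k} {N} (λ j → sumFrom (aboveLevel k j) k N) d T
      λ j d≤j → sumFrom-aboveLevel-≥ {k} {j} k N (≤-trans k≤2^[1+d] (^-monoʳ-≤ 2 (s≤s d≤j)))
    σMMR-bound : 2 * E * 2 ^ d * (N * d) + 2 * E * (N * k) ≤ 2 * E * 2 ^ d * (T * k + SR) + 2 ^ d * N
    σMMR-bound = σMMR-estimate {E} {k} {N} {2 ^ d} {2 ^ T} {T} {W} {d} {SR} {{m^n≢0 2 d}} {{m^n≢0 2 T}}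
      (sumFrom-σMMR-≥ {k} {d} N T 1≤k 2^d≤k) levels (<⇒≤ (n<2^n T))

lemma26 : (k : ℕ) → 1 ≤ k → (ε : ℚ) → 0ℚ ℚ.< ε →
    ∃[ N₀ ] ((N : ℕ) → .{{_ : NonZero N}} → N₀ ≤ N →
    ((+ 5 / 4) - (+ 3 / (2 * suc k))) - ε ℚ.≤ avgDiff k N)
lemma26 k 1≤k ε 0<ε with positive⇒1/suc≤ ε 0<ε
... | e , 1/E≤ε with avgDiff-≥ e 1≤k
... | N₀ , bound = N₀ , λ N N₀≤N →
  ℚₚ.≤-trans (ℚₚ.+-monoʳ-≤ ((+ 5 / 4) - (+ 3 / (2 * suc k))) (ℚₚ.neg-antimono-≤ 1/E≤ε)) (bound N N₀≤N)
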